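{- Let $\mathcal{M}$ be a Minsky machine satisfying the standing assumptions below and let $m\ge1$. The following are equivalent: (1) $\mathcal{M}$ halts with capacity $m-1$; (2) $S_m$ is halting; (3) for every $\ell$, every computational relation $R\le\mathbb{A}(\mathcal{M})^\ell$ with capacity $m-1$ is halting.
   Context: Minsky machines. A Minsky machine $\mathcal{M}$ has states $\{0,1,\dots,N\}$ ($0$ is the halting state, $1$ the initial state), two registers $A,B$ holding values in $\mathbb{N}$, and a finite set of instructions of the forms $(i,R,j)$ and $(i,R,k,j)$ with $R\in\{A,B\}$. It acts on configurations $(s,\alpha,\beta)\in\{0,\dots,N\}\times\mathbb{N}\times\mathbb{N}$: $\mathcal{M}(i,\alpha,\beta)$ is $(j,\alpha+1,\beta)$ if $(i,A,j)\in\mathcal{M}$; $(j,\alpha,\beta+1)$ if $(i,B,j)\in\mathcal{M}$; $(j,\alpha-1,\beta)$ if $(i,A,k,j)\in\mathcal{M}$ and $\alpha\neq0$; $(j,\alpha,\beta-1)$ if $(i,B,k,j)\in\mathcal{M}$ and $\beta\ne 0$; $(k,\alpha,\beta)$ if $(i,A,k,j)\in\mathcal{M}$ and $\alpha=0$, or $(i,B,k,j)\in\mathcal{M}$ and $\beta=0$; and $(0,\alpha,\beta)$ if $i=0$. $\mathcal{M}^n$ denotes the $n$-fold composite, and $\mathcal{M}$ halts if $\mathcal{M}^n(1,0,0)$ has state $0$ for some $n$. Standing assumptions on $\mathcal{M}$: it returns both registers to $0$ before halting; it has exactly one instruction $(i,\dots)$ for each non-halting state $i$; the instruction for state $1$ has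 the form $(1,R,s)$; and in the state graph (vertices the states, an edge $i\to j$ iff $\mathcal{M}(i,\alpha,\beta)=(j,\alpha',\beta')$ for some $\alpha,\beta,\alpha',\beta'$) every state is reachable from $1$ and $0$ is reachable from every state. $\mathcal{M}$ has capacity $C$ if $C\ge\alpha+\beta$ whenever $\mathcal{M}^n(1,0,0)=(i,\alpha,\beta)$ for some $n$; it halts with capacity $C$ if it has capacity $C$ and halts. The algebra. $A(\mathcal{M})=\{\langle i,c\rangle: 0\le i\le N,\ c\in\{\bullet,\times,0,A,B\}\}$. Put $X=\{\langle i,\times\rangle\}$, $D=\{\langle i,\bullet\rangle\}$, $C=A(\mathcal{M})\setminus(X\cup D)$, $Y=A(\mathcal{M})\setminus X$; $\mathrm{X}(\langle i,c\rangle)=\langle i,\times\rangle$, $\mathrm{State}(\langle i,c\rangle)=i$, $\mathrm{Content}(\langle i,c\rangle)=c$. Write "$(i,R,\dots,j)\in\mathcal{M}$" to mean $(i,R,j)\in\mathcal{M}$ or $(i,R,k,j)\in\mathcal{M}$ for some $k$. The operations (cases read in order, first applicable case applies): $\langle i,c\rangle\wedge\langle j,d\rangle$ is $\langle i,c\rangle$ if the two are equal, else $\langle\min(i,j),\times\rangle$. $M(x,y)$: $\langle j,R\rangle$ if $x=\langle i,\bullet\rangle, y=\langle i,0\rangle,(i,R,j)\in\mathcal{M}$; $\langle j,0\rangle$ if $x=\langle i,\bullet\rangle,y=\langle i,R\rangle,(i,R,k,j)\in\mathcal{M}$; $\langle j,\bullet\rangle$ if $x=\langle i,0\rangle,y=\langle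 i,\bullet\rangle,(i,R,j)\in\mathcal{M}$; $\langle j,\bullet\rangle$ if $x=\langle i,R\rangle,y=\langle i,\bullet\rangle,(i,R,k,j)\in\mathcal{M}$; $\langle j,c\rangle$ if $x=y=\langle i,c\rangle$, $c\ne\bullet$, $(i,R,\dots,j)\in\mathcal{M}$; $\langle j,\times\rangle$ if $\mathrm{State}(x)=\mathrm{State}(y)=i$ and $(i,R,\dots,j)\in\mathcal{M}$; otherwise $\mathrm{X}(y)$. $M'(x)$: $\langle k,c\rangle$ if $x=\langle i,c\rangle$, $(i,R,k,j)\in\mathcal{M}$, $c\neq R$; $\langle k,\times\rangle$ if $\mathrm{State}(x)=i$ and $(i,R,k,j)\in\mathcal{M}$; otherwise $\mathrm{X}(x)$. $I(x,y)$: $\langle1,\bullet\rangle$ if $x\in D$; $\langle 1,0\rangle$ if $y\in C$; otherwise $\langle1,\times\rangle$. $H(x)$: $\langle0,0\rangle$ if $x\in\{\langle0,0\rangle,\langle0,\bullet\rangle\}$, otherwise $\langle0,\times\rangle$. $N_0(x,y,z)$: $y$ if $x=\langle0,\bullet\rangle$ and $\mathrm{State}(y)=\mathrm{State}(z)$; $z$ if $x=\langle0,0\rangle$, $z\notin D$, $\mathrm{State}(y)=\mathrm{State}(z)$; otherwise $\mathrm{X}(y\wedge z)$. $S(x,y,z)$: $\langle1,0\rangle$ if $x=\langle1,0\rangle$, $\mathrm{State}(y)=\mathrm{State}(z)=1$ and $(\mathrm{Content}(y),\mathrm{Content}(z))\in\{(\bullet,0),(0,\bullet),(0,0)\}$;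 otherwise $\langle1,\times\rangle$. $N_\bullet(u,x,y,z)$, where the first four cases require $\mathrm{State}(x)=\mathrm{State}(y)=\mathrm{State}(z)$: $x$ if $x=y\notin X$; $x$ if $u\in D$, $y\in X$; $y$ if $u\in D$, $x\in X$; $z$ if $u\in D$, $z\in\{x,y\}$; otherwise $\mathrm{X}(x\wedge y\wedge z)$. $P(u,v,x,y)$: $x$ if $\mathrm{State}(u)=\mathrm{State}(v)$, else $y$. $\mathbb{A}(\mathcal{M})=\langle A(\mathcal{M});\wedge,M,M',I,H,N_0,S,N_\bullet,P\rangle$; operations act coordinatewise on powers, and a relation $R\le\mathbb{A}(\mathcal{M})^\ell$ is a (nonempty) subuniverse of $A(\mathcal{M})^\ell$. Relation notions. A tuple $s\in A(\mathcal{M})^\ell$ is synchronized if $\mathrm{State}(s(i))$ is the same for all $i$; a set of tuples is synchronized if all its elements are. $R$ is computational if it is synchronized and every $r\in R$ has at most one coordinate in $D$. $R$ is halting if it contains some $r\in\{\langle0,0\rangle,\langle0,\bullet\rangle\}^\ell\setminus\{\langle0,0\rangle\}^\ell$. $R$ has capacity $C$ if $|\{i\in[\ell]:\exists r\in R\cap Y^\ell,\ r(i)\in D\}|>C$. For $i\in[m]$ let $\sigma_i\in A(\mathcal{M})^m$ have $\sigma_i(i)=\langle1,\bullet\rangle$ and $\sigma_i(j)=\langle1,0\rangle$ for $j\ne i$; $S_m$ is the subuniverse of $A(\mathcal{M})^m$ generated by $\{\sigma_1,\dots,\sigma_m\}$. -}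

module Defs where

open import Level using (0ℓ)
open import Data.Nat using (ℕ; zero; suc; _+_; _≤_; _<_; _≤ᵇ_)
open import Data.Fin using (Fin; zero; suc; toℕ; _≟_)
open import Data.Bool using (Bool; true; false; if_then_else_; _∧_; _∨_; not)
open import Data.Maybe using (Maybe; just; nothing)
open import Data.Product using (Σ; ∃; _×_; _,_; proj₁; proj₂)
open import Data.Sum using (_⊎_)
open import Data.Vec using (Vec; lookup; tabulate)
open import Relation.Nullary using (¬_; does)
open import Relation.Unary using (Pred; _∈_)
open import Relation.Binary.PropositionalEquality using (_≡_)
open import Relation.Binary.Construct.Closure.ReflexiveTransitive using (Star)
open import Function.Definitions using (Injective)

-- A machine with states {0,1,…,N} is represented with N = suc n (the
-- standing assumptions require an instruction for state 1, so N ≥ 1).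
-- Since there is exactly one instruction per non-halting state, the set
-- of instructions is given as a function δ : Fin (suc n) → Instr, where
-- the instruction of state (suc p) is δ p.

data Reg : Set where
  RA RB : Reg

State : ℕ → Set
State n = Fin (suc (suc n))

-- inc R j      is the instruction (i,R,j)
-- dec R k j    is the instruction (i,R,k,j)
data Instr (n : ℕ) : Set where
  inc : Reg → State n → Instr n
  dec : Reg → State n → State n → Instr n

record Machine (n : ℕ) : Set where
  field
    δ : Fin (suc n) → Instr n
open Machine public

one : ∀ {n} → State n
one = suc zero

instr : ∀ {n} → Machine n → State n → Maybe (Instr n)
instr M zero    = nothing
instr M (suc p) = just (δ M p)

Config : ℕ → Set
Config n = State n × ℕ × ℕ

step : ∀ {n} → Machine n → Config n → Config n
step M (zero , a , b) = (zero , a , b)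
step M (suc p , a , b) with δ M p
... | inc RA j = (j , suc a , b)
... | inc RB j = (j , a , suc b)
... | dec RA k j with a
...   | zero   = (k , zero , b)
...   | suc a' = (j , a' , b)
step M (suc p , a , b) | dec RB k j with b
...   | zero   = (k , a , zero)
...   | suc b' = (j , a , b')

run : ∀ {n} → Machine n → ℕ → Config n → Config n
run M zero    c = c
run M (suc t) c = step M (run M t c)

init : ∀ {n} → Config n
init = (one , 0 , 0)

Halts : ∀ {n} → Machine n → Set
Halts M = ∃ λ t → proj₁ (run M t init) ≡ zero

HasCapacity : ∀ {n} → Machine n → ℕ → Set
HasCapacity M C = ∀ t i α β → run M t init ≡ (i , α , β) → α + β ≤ C

HaltsWithCapacity : ∀ {n} → Machine n → ℕ → Set
HaltsWithCapacity M C = HasCapacity M C × Halts M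

Edge : ∀ {n} → Machine n → State n → State n → Set
Edge M i j = ∃ λ α → ∃ λ β → ∃ λ α' → ∃ λ β' → step M (i , α , β) ≡ (j , α' , β')

Reachable : ∀ {n} → Machine n → State n → State n → Set
Reachable M = Star (Edge M)

-- standing assumptions (the "exactly one instruction per non-halting
-- state" assumption is built into the representation `Machine`)
record Standing {n} (M : Machine n) : Set where
  field
    clears    : ∀ t α β → run M t init ≡ (zero , α , β) → (α ≡ 0) × (β ≡ 0)
    firstInc  : ∃ λ R → ∃ λ s → δ M zero ≡ inc R s
    fromOne   : ∀ i → Reachable M one i
    toHalt    : ∀ i → Reachable M i zero

-- bul = •, crs = ×, zer = 0, cA = A, cB = B
data Content : Set where
  bul crs zer cA cB : Content

reg : Reg → Content
reg RA = cA
reg RB = cB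

_==_ : Content → Content → Bool
bul == bul = true
crs == crs = true
zer == zer = true
cA  == cA  = true
cB  == cB  = true
_   == _   = false

Elem : ℕ → Set
Elem n = State n × Content

module _ {n : ℕ} where

  st : Elem n → State n
  st = proj₁

  ct : Elem n → Content
  ct = proj₂

  _=ˢ_ : State n → State n → Bool
  i =ˢ j = does (i ≟ j)

  _=ᵉ_ : Elem n → Elem n → Bool
  (i , c) =ᵉ (j , d) = (i =ˢ j) ∧ (c == d)

  minS : State n → State n → State n
  minS i j = if toℕ i ≤ᵇ toℕ j then i else j

  isD isX isC : Elem n → Bool
  isD x = ct x == bul
  isX x = ct x == crs
  isC x = not (isD x) ∧ not (isX x)

  InX InD InY : Elem n → Set
  InX x = ct x ≡ crs
  InD x = ct x ≡ bul
  InY x = ¬ InX x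

  Xf : Elem n → Elem n
  Xf (i , _) = (i , crs)

  _⊓_ : Elem n → Elem n → Elem n
  x ⊓ y = if x =ᵉ y then x else (minS (st x) (st y) , crs)

module Ops {n : ℕ} (M : Machine n) where

  opM : Elem n → Elem n → Elem n
  opM x y = if st x =ˢ st y then sameState (instr M (st x)) else Xf y
    where
    c = ct x
    d = ct y
    sameState : Maybe (Instr n) → Elem n
    sameState nothing = Xf y
    sameState (just (inc R j)) =
      if (c == bul) ∧ (d == zer) then (j , reg R)
      else if (c == zer) ∧ (d == bul) then (j , bul)
      else if (c == d) ∧ not (c == bul) then (j , c)
      else (j , crs)
    sameState (just (dec R k j)) =
      if (c == bul) ∧ (d == reg R) then (j , zer)
      else if (c == reg R) ∧ (d == bul) then (j , bul)
      else if (c == d) ∧ not (c == bul) then (j , c)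
      else (j , crs)

  opM' : Elem n → Elem n
  opM' x with instr M (st x)
  ... | just (dec R k j) = if not (ct x == reg R) then (k , ct x) else (k , crs)
  ... | _ = Xf x

  opI : Elem n → Elem n → Elem n
  opI x y = if isD x then (one , bul) else if isC y then (one , zer) else (one , crs)

  opH : Elem n → Elem n
  opH x = if (x =ᵉ (zero , zer)) ∨ (x =ᵉ (zero , bul)) then (zero , zer) else (zero , crs)

  opN₀ : Elem n → Elem n → Elem n → Elem n
  opN₀ x y z =
    if (x =ᵉ (zero , bul)) ∧ (st y =ˢ st z) then y
    else if (x =ᵉ (zero , zer)) ∧ not (isD z) ∧ (st y =ˢ st z) then z
    else Xf (y ⊓ z)

  opS : Elem n → Elem n → Elem n → Elem n
  opS x y z =
    if (x =ᵉ (one , zer)) ∧ (st y =ˢ one) ∧ (st z =ˢ one) ∧ okPair (ct y) (ct z)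
    then (one , zer) else (one , crs)
    where
    okPair : Content → Content → Bool
    okPair bul zer = true
    okPair zer bul = true
    okPair zer zer = true
    okPair _   _   = false

  opN• : Elem n → Elem n → Elem n → Elem n → Elem n
  opN• u x y z =
    if sync ∧ (x =ᵉ y) ∧ not (isX x) then x
    else if sync ∧ isD u ∧ isX y then x
    else if sync ∧ isD u ∧ isX x then y
    else if sync ∧ isD u ∧ ((z =ᵉ x) ∨ (z =ᵉ y)) then z
    else Xf ((x ⊓ y) ⊓ z)
    where
    sync = (st x =ˢ st y) ∧ (st y =ˢ st z)

  opP : Elem n → Elem n → Elem n → Elem n → Elem n
  opP u v x y = if st u =ˢ st v then x else y

  Tuple : ℕ → Set
  Tuple ℓ = Vec (Elem n) ℓ

  lift1 : ∀ {ℓ} → (Elem n → Elem n) → Tuple ℓ → Tuple ℓ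
  lift1 f r = tabulate λ i → f (lookup r i)

  lift2 : ∀ {ℓ} → (Elem n → Elem n → Elem n) → Tuple ℓ → Tuple ℓ → Tuple ℓ
  lift2 f r s = tabulate λ i → f (lookup r i) (lookup s i)

  lift3 : ∀ {ℓ} → (Elem n → Elem n → Elem n → Elem n) →
          Tuple ℓ → Tuple ℓ → Tuple ℓ → Tuple ℓ
  lift3 f r s t = tabulate λ i → f (lookup r i) (lookup s i) (lookup t i)

  lift4 : ∀ {ℓ} → (Elem n → Elem n → Elem n → Elem n → Elem n) →
          Tuple ℓ → Tuple ℓ → Tuple ℓ → Tuple ℓ → Tuple ℓ
  lift4 f r s t u = tabulate λ i → f (lookup r i) (lookup s i) (lookup t i) (lookup u i)

  record IsRelation {ℓ} (R : Pred (Tuple ℓ) 0ℓ) : Set where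
    field
      nonempty : ∃ λ r → r ∈ R
      cl-∧  : ∀ {r s} → r ∈ R → s ∈ R → lift2 _⊓_ r s ∈ R
      cl-M  : ∀ {r s} → r ∈ R → s ∈ R → lift2 opM r s ∈ R
      cl-M' : ∀ {r} → r ∈ R → lift1 opM' r ∈ R
      cl-I  : ∀ {r s} → r ∈ R → s ∈ R → lift2 opI r s ∈ R
      cl-H  : ∀ {r} → r ∈ R → lift1 opH r ∈ R
      cl-N₀ : ∀ {r s t} → r ∈ R → s ∈ R → t ∈ R → lift3 opN₀ r s t ∈ R
      cl-S  : ∀ {r s t} → r ∈ R → s ∈ R → t ∈ R → lift3 opS r s t ∈ R
      cl-N• : ∀ {r s t u} → r ∈ R → s ∈ R → t ∈ R → u ∈ R → lift4 opN• r s t u ∈ R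
      cl-P  : ∀ {r s t u} → r ∈ R → s ∈ R → t ∈ R → u ∈ R → lift4 opP r s t u ∈ R

  Synchronized : ∀ {ℓ} → Tuple ℓ → Set
  Synchronized r = ∀ i j → st (lookup r i) ≡ st (lookup r j)

  Computational : ∀ {ℓ} → Pred (Tuple ℓ) 0ℓ → Set
  Computational R = ∀ r → r ∈ R →
    Synchronized r × (∀ i j → InD (lookup r i) → InD (lookup r j) → i ≡ j)

  Halting : ∀ {ℓ} → Pred (Tuple ℓ) 0ℓ → Set
  Halting R = ∃ λ r → r ∈ R ×
    (∀ i → (lookup r i ≡ (zero , zer)) ⊎ (lookup r i ≡ (zero , bul))) ×
    ¬ (∀ i → lookup r i ≡ (zero , zer))

  DCoords : ∀ {ℓ} → Pred (Tuple ℓ) 0ℓ → Fin ℓ → Set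
  DCoords R i = ∃ λ r → r ∈ R × (∀ j → InY (lookup r j)) × InD (lookup r i)

  -- R has capacity C : |DCoords R| > C, i.e. DCoords R contains C+1
  -- pairwise distinct coordinates
  RelCapacity : ∀ {ℓ} → Pred (Tuple ℓ) 0ℓ → ℕ → Set
  RelCapacity {ℓ} R C =
    ∃ λ (f : Fin (suc C) → Fin ℓ) → Injective _≡_ _≡_ f × (∀ k → DCoords R (f k))

  σ : ∀ {m} → Fin m → Tuple m
  σ i = tabulate λ j → if does (i ≟ j) then (one , bul) else (one , zer)

  data S (m : ℕ) : Pred (Tuple m) 0ℓ where
    gen  : ∀ i → S m (σ i)
    g-∧  : ∀ {r s} → S m r → S m s → S m (lift2 _⊓_ r s)
    g-M  : ∀ {r s} → S m r → S m s → S m (lift2 opM r s)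
    g-M' : ∀ {r} → S m r → S m (lift1 opM' r)
    g-I  : ∀ {r s} → S m r → S m s → S m (lift2 opI r s)
    g-H  : ∀ {r} → S m r → S m (lift1 opH r)
    g-N₀ : ∀ {r s t} → S m r → S m s → S m t → S m (lift3 opN₀ r s t)
    g-S  : ∀ {r s t} → S m r → S m s → S m t → S m (lift3 opS r s t)
    g-N• : ∀ {r s t u} → S m r → S m s → S m t → S m u → S m (lift4 opN• r s t u)
    g-P  : ∀ {r s t u} → S m r → S m s → S m t → S m u → S m (lift4 opP r s t u)

-- A column carrying one bullet • and otherwise contents 0, A, B, all at state i, encodes
-- the configuration (i, #A, #B).  On such encodings M performs the increments and
-- decrements of the machine (the bullet of its first argument moves to where its second
-- argument has its bullet), and M′ performs the zero tests.
--
-- (1 ⇒ 3) In a computational relation R of capacity m − 1, I turns the m witnesses of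
-- the capacity into the initial configuration written on m coordinates.  By induction
-- along the run, every encoding of every reached configuration lies in R: after an
-- increment or decrement it is M(x, y) for two encodings x, y of the previous
-- configuration (for a decrement these need a 0 of the new encoding, which exists since at
-- most m − 1 tokens occupy m coordinates), and after a zero test it is M′ of an encoding.
-- The final configuration (0, 0, 0) gives a halting tuple.
-- (3 ⇒ 2) S_m is a computational relation of capacity m − 1.
-- (2 ⇒ 1) Every tuple of S_m is synchronized, has at most one bullet, and, if it has
-- no ×, either the machine halts within capacity m − 1 or the tuple encodes a
-- configuration reached without exceeding m − 1 tokens.  Every operation preserves
-- this, so a halting tuple of S_m exhibits a reached halting configuration.

module Submission where

open import Defs
open import Function.Bundles using (_⇔_; mk⇔)
open import Level using (0ℓ)
open import Data.Nat using (ℕ; zero; suc; _+_; _≤_; _<_; _∸_; _≤ᵇ_; z≤n; s≤s)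
open import Data.Nat.Properties
  using (+-0-commutativeMonoid; +-comm; +-identityʳ; +-suc; +-mono-≤; m+n≡0⇒m≡0;
         ≤-trans; ≤-refl; <⇒≱; ≰⇒>; n≤1+n; m∸n+n≡m; m≤n⇒m<n∨m≡n; _≤?_)
open import Data.Nat.Tactic.RingSolver using (solve-∀)
open import Algebra.Properties.CommutativeMonoid.Sum +-0-commutativeMonoid
  using (sum; sum-remove; sum-cong-≗; ∑-distrib-+)
open import Data.Bool using (Bool; true; false; if_then_else_; _∧_; _∨_; not)
open import Data.Bool.Properties using (∧-zeroʳ)
open import Data.Fin using (Fin; zero; suc; _≟_; punchIn; toℕ)
open import Data.Fin.Properties using (punchInᵢ≢i; any?)
open import Data.Vec using (lookup; tabulate)
open import Data.Vec.Properties using (lookup∘tabulate; tabulate-cong)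
open import Data.Vec.Functional using (updateAt; removeAt)
open import Data.Vec.Functional.Properties using (updateAt-updates; updateAt-minimal)
open import Data.Maybe using (just; nothing)
open import Data.Product using (∃; _×_; _,_; proj₁; proj₂)
open import Data.Sum using (_⊎_; inj₁; inj₂; map₂; [_,_]′)
open import Function using (_∘_; id; const)
open import Function.Definitions using (Injective)
open import Relation.Nullary using (¬_; Dec; yes; no; does; contradiction)
open import Relation.Nullary.Decidable using (dec-true; dec-false; does-⇔)
open import Relation.Binary.Definitions using (DecidableEquality)
open import Relation.Unary using (Pred; _∈_)
open import Relation.Binary.PropositionalEquality

if-elim : ∀ {A : Set} (P : A → Set) b {x y : A} →
          (b ≡ true → P x) → (b ≡ false → P y) → P (if b then x else y)
if-elim P true  p _ = p refl
if-elim P false _ q = q refl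

-- Only the first conjunct is given; unification finds the rest, even when it mentions
-- helpers local to Defs (such as the pair test inside opS).
if∧-elim : ∀ {A : Set} (P : A → Set) a {b} {x y : A} →
           (a ∧ b ≡ true → P x) → (a ∧ b ≡ false → P y) → P (if a ∧ b then x else y)
if∧-elim P a {b} = if-elim P (a ∧ b)

∨-true : ∀ {a b} → a ∨ b ≡ true → a ≡ true ⊎ b ≡ true
∨-true {true}  _ = inj₁ refl
∨-true {false} e = inj₂ e

∧-true : ∀ {a b} → a ∧ b ≡ true → a ≡ true × b ≡ true
∧-true {true} {true} _ = refl , refl

==-refl : ∀ c → (c == c) ≡ true
==-refl bul = refl
==-refl crs = refl
==-refl zer = refl
==-refl cA  = refl
==-refl cB  = refl

==⇒≡ : ∀ {c d} → (c == d) ≡ true → c ≡ d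
==⇒≡ {bul} {bul} _ = refl
==⇒≡ {crs} {crs} _ = refl
==⇒≡ {zer} {zer} _ = refl
==⇒≡ {cA}  {cA}  _ = refl
==⇒≡ {cB}  {cB}  _ = refl

≢⇒==-false : ∀ {c d} → c ≢ d → (c == d) ≡ false
≢⇒==-false {c} {d} c≢d with c == d in e
... | true  = contradiction (==⇒≡ e) c≢d
... | false = refl

==-false⇒≢ : ∀ {c d} → (c == d) ≡ false → c ≢ d
==-false⇒≢ {c} e refl = contradiction (trans (sym (==-refl c)) e) λ ()

not==⇒≢ : ∀ {c d} → not (c == d) ≡ true → c ≢ d
not==⇒≢ {c} {d} e with c == d in c≡d
... | false = ==-false⇒≢ c≡d

_≟ᶜ_ : DecidableEquality Content
c ≟ᶜ d with c == d in e
... | true  = yes (==⇒≡ e)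
... | false = no (==-false⇒≢ e)

=ˢ-refl : ∀ {n} (i : State n) → (i =ˢ i) ≡ true
=ˢ-refl i = dec-true (i ≟ i) refl

=ˢ⇒≡ : ∀ {n} {i j : State n} → (i =ˢ j) ≡ true → i ≡ j
=ˢ⇒≡ {i = i} {j} e with i ≟ j
... | yes i≡j = i≡j

=ᵉ⇒≡ : ∀ {n} {a b : Elem n} → (a =ᵉ b) ≡ true → a ≡ b
=ᵉ⇒≡ {a = i , c} {j , d} e with ∧-true {i =ˢ j} e
... | i≡j , c≡d = cong₂ _,_ (=ˢ⇒≡ i≡j) (==⇒≡ c≡d)

reg≢bul : ∀ R → reg R ≢ bul
reg≢bul RA ()
reg≢bul RB ()

reg≢crs : ∀ R → reg R ≢ crs
reg≢crs RA ()
reg≢crs RB ()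

reg≢zer : ∀ R → reg R ≢ zer
reg≢zer RA ()
reg≢zer RB ()

module _ {n : ℕ} where

  minS-idem : ∀ (i : State n) → minS i i ≡ i
  minS-idem i = if-elim (_≡ i) (toℕ i ≤ᵇ toℕ i) (λ _ → refl) (λ _ → refl)

  minS-≡ˡ : ∀ {i j : State n} → i ≡ j → minS i j ≡ i
  minS-≡ˡ {i} refl = minS-idem i

  minS-≡ʳ : ∀ {i j : State n} → i ≡ j → minS i j ≡ j
  minS-≡ʳ {i} refl = minS-idem i

  elem-at : ∀ {a : Elem n} {i} → st a ≡ i → a ≡ (i , ct a)
  elem-at refl = refl

  if-pair : ∀ b {i : State n} → (if b then (i , bul) else (i , zer)) ≡ (i , (if b then bul else zer))
  if-pair true  = refl
  if-pair false = refl

  D⇒Y : ∀ {a : Elem n} → InD a → InY a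
  D⇒Y a∈D a∈X = contradiction (trans (sym a∈D) a∈X) λ ()

occ : Reg → Content → ℕ
occ _  bul = 0
occ _  crs = 0
occ _  zer = 0
occ RA cA  = 1
occ RB cA  = 0
occ RA cB  = 0
occ RB cB  = 1

occ-reg : ∀ R → occ R (reg R) ≡ 1
occ-reg RA = refl
occ-reg RB = refl

occ-≢reg : ∀ R {c} → c ≢ reg R → occ R c ≡ 0
occ-≢reg _  {bul} _ = refl
occ-≢reg _  {crs} _ = refl
occ-≢reg _  {zer} _ = refl
occ-≢reg RA {cA}  c≢A = contradiction refl c≢A
occ-≢reg RB {cA}  _ = refl
occ-≢reg RA {cB}  _ = refl
occ-≢reg RB {cB}  c≢B = contradiction refl c≢B

tokens≤1 : ∀ c → occ RA c + occ RB c ≤ 1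
tokens≤1 bul = z≤n
tokens≤1 crs = z≤n
tokens≤1 zer = z≤n
tokens≤1 cA  = s≤s z≤n
tokens≤1 cB  = s≤s z≤n

tokens≥1 : ∀ {c} → c ≢ bul → c ≢ crs → c ≢ zer → 1 ≤ occ RA c + occ RB c
tokens≥1 {bul} c≢• _ _ = contradiction refl c≢•
tokens≥1 {crs} _ c≢× _ = contradiction refl c≢×
tokens≥1 {zer} _ _ c≢0 = contradiction refl c≢0
tokens≥1 {cA}  _ _ _ = s≤s z≤n
tokens≥1 {cB}  _ _ _ = s≤s z≤n

sum≤ : ∀ {m} (t : Fin m → ℕ) → (∀ k → t k ≤ 1) → sum t ≤ m
sum≤ {zero}  t t≤1 = z≤n
sum≤ {suc m} t t≤1 = +-mono-≤ (t≤1 _) (sum≤ (t ∘ suc) (t≤1 ∘ suc))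

sum≥ : ∀ {m} (t : Fin m → ℕ) → (∀ k → 1 ≤ t k) → m ≤ sum t
sum≥ {zero}  t 1≤t = z≤n
sum≥ {suc m} t 1≤t = +-mono-≤ (1≤t _) (sum≥ (t ∘ suc) (1≤t ∘ suc))

sum-agree-off : ∀ {m} (t t′ : Fin (suc m) → ℕ) p →
                (∀ k → k ≢ p → t k ≡ t′ k) → sum t + t′ p ≡ sum t′ + t p
sum-agree-off t t′ p agree = begin
  sum t + t′ p                      ≡⟨ cong (_+ t′ p) (sum-remove t) ⟩
  t p + sum (removeAt t p) + t′ p   ≡⟨ cong (λ s → t p + s + t′ p) rest ⟩
  t p + sum (removeAt t′ p) + t′ p  ≡⟨ swap (t p) _ (t′ p) ⟩
  t′ p + sum (removeAt t′ p) + t p  ≡⟨ cong (_+ t p) (sum-remove t′) ⟨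
  sum t′ + t p                      ∎
  where
  open ≡-Reasoning
  rest : sum (removeAt t p) ≡ sum (removeAt t′ p)
  rest = sum-cong-≗ λ k → agree (punchIn p k) (punchInᵢ≢i p k)
  swap : ∀ a s b → a + s + b ≡ b + s + a
  swap = solve-∀

sum-agree-off₂ : ∀ {m} (t t′ : Fin (suc m) → ℕ) {p q} → p ≢ q →
                 (∀ k → k ≢ p → k ≢ q → t k ≡ t′ k) →
                 sum t + t′ p + t′ q ≡ sum t′ + t p + t q
sum-agree-off₂ t t′ {p} {q} p≢q agree = begin
  sum t + t′ p + t′ q   ≡⟨ cong (λ s → sum t + s + t′ q) hp ⟨
  sum t + h p + t′ q    ≡⟨ cong (_+ t′ q) (sum-agree-off t h p t≈h) ⟩
  sum h + t p + t′ q    ≡⟨ swap (sum h) (t p) (t′ q) ⟩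
  sum h + t′ q + t p    ≡⟨ cong (_+ t p) (sum-agree-off h t′ q h≈t′) ⟩
  sum t′ + h q + t p    ≡⟨ cong (λ s → sum t′ + s + t p) hq ⟩
  sum t′ + t q + t p    ≡⟨ swap (sum t′) (t q) (t p) ⟩
  sum t′ + t p + t q    ∎
  where
  open ≡-Reasoning
  h : Fin _ → ℕ
  h = updateAt t′ q (const (t q))
  hq : h q ≡ t q
  hq = updateAt-updates q t′
  hp : h p ≡ t′ p
  hp = updateAt-minimal p q t′ p≢q
  t≈h : ∀ k → k ≢ p → t k ≡ h k
  t≈h k k≢p with k ≟ q
  ... | yes refl = sym hq
  ... | no k≢q   = trans (agree k k≢p k≢q) (sym (updateAt-minimal k q t′ k≢q))
  h≈t′ : ∀ k → k ≢ q → h k ≡ t′ k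
  h≈t′ k k≢q = updateAt-minimal k q t′ k≢q
  swap : ∀ a b c → a + b + c ≡ a + c + b
  swap = solve-∀

count : ∀ {m} → Reg → (Fin m → Content) → ℕ
count R c = sum (occ R ∘ c)

registers : ∀ {m} → (Fin m → Content) → ℕ × ℕ
registers c = count RA c , count RB c

count-cong : ∀ {m} R {c c′ : Fin m → Content} → (∀ k → c k ≡ c′ k) → count R c ≡ count R c′
count-cong R c≗c′ = sum-cong-≗ (cong (occ R) ∘ c≗c′)

registers-cong : ∀ {m} {c c′ : Fin m → Content} → (∀ k → c k ≡ c′ k) → registers c ≡ registers c′
registers-cong c≗c′ = cong₂ _,_ (count-cong RA c≗c′) (count-cong RB c≗c′)

absent⇒count≡0 : ∀ {m} R (c : Fin m → Content) → (∀ k → c k ≢ reg R) → count R c ≡ 0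
absent⇒count≡0 {zero}  R c absent = refl
absent⇒count≡0 {suc m} R c absent =
  cong₂ _+_ (occ-≢reg R (absent zero)) (absent⇒count≡0 R (c ∘ suc) (absent ∘ suc))

count≡0⇒absent : ∀ {m} R (c : Fin (suc m) → Content) → count R c ≡ 0 → ∀ k → c k ≢ reg R
count≡0⇒absent R c count≡0 k ck≡R = contradiction 1≡0 λ ()
  where
  open ≡-Reasoning
  1≡0 : 1 ≡ 0
  1≡0 = begin
    1             ≡⟨ occ-reg R ⟨
    occ R (reg R) ≡⟨ cong (occ R) ck≡R ⟨
    occ R (c k)   ≡⟨ m+n≡0⇒m≡0 _ (trans (sym (sum-remove (occ R ∘ c))) count≡0) ⟩
    0             ∎

count-suc⇒present : ∀ {m} R (c : Fin m → Content) {a} → count R c ≡ suc a → ∃ λ k → c k ≡ reg R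
count-suc⇒present R c count≡1+a with any? (λ k → c k ≟ᶜ reg R)
... | yes present = present
... | no  absent  = contradiction (trans (sym count≡1+a) (absent⇒count≡0 R c λ k ck≡R → absent (k , ck≡R))) λ ()

record Valid {m} (c : Fin m → Content) : Set where
  field
    uncrossed   : ∀ k → c k ≢ crs
    bullet      : Fin m
    at-bullet   : c bullet ≡ bul
    sole-bullet : ∀ k → c k ≡ bul → k ≡ bullet

load : ℕ × ℕ → ℕ
load (a , b) = a + b

module _ {m} {c : Fin (suc m) → Content} (valid : Valid c) where
  open Valid valid

  private
    tokens : Fin (suc m) → ℕ
    tokens k = occ RA (c k) + occ RB (c k)

    load≡rest : load (registers c) ≡ sum (removeAt tokens bullet)
    load≡rest = begin
      count RA c + count RB c              ≡⟨ ∑-distrib-+ (occ RA ∘ c) (occ RB ∘ c) ⟨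
      sum tokens                           ≡⟨ sum-remove tokens ⟩
      tokens bullet + rest                 ≡⟨ cong (λ d → occ RA d + occ RB d + rest) at-bullet ⟩
      rest                                 ∎
      where
      open ≡-Reasoning
      rest = sum (removeAt tokens bullet)

  load≤ : load (registers c) ≤ m
  load≤ = subst (_≤ m) (sym load≡rest) (sum≤ _ λ k → tokens≤1 (c (punchIn bullet k)))

  load<⇒zero : load (registers c) < m → ∃ λ k → c k ≡ zer
  load<⇒zero load<m with any? (λ k → c k ≟ᶜ zer)
  ... | yes found = found
  ... | no  none  = contradiction (subst (m ≤_) (sym load≡rest) (sum≥ _ nonzero)) (<⇒≱ load<m)
    where
    nonzero : ∀ k → 1 ≤ tokens (punchIn bullet k)
    nonzero k = tokens≥1 (λ b → punchInᵢ≢i bullet k (sole-bullet _ b)) (uncrossed _) (λ z → none (_ , z))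

initial : ∀ {m} → Fin m → Fin m → Content
initial k l = if does (k ≟ l) then bul else zer

registers-initial : ∀ {m} (k : Fin m) → registers (initial k) ≡ (0 , 0)
registers-initial k =
  cong₂ _,_ (absent⇒count≡0 RA (initial k) (no-register RA)) (absent⇒count≡0 RB (initial k) (no-register RB))
  where
  no-register : ∀ R l → initial k l ≢ reg R
  no-register R l with k ≟ l
  ... | yes _ = λ •≡R → reg≢bul R (sym •≡R)
  ... | no  _ = λ 0≡R → reg≢zer R (sym 0≡R)

valid-initial : ∀ {m} (k : Fin m) → Valid (initial k)
valid-initial k = record { uncrossed = uncrossed ; bullet = k ; at-bullet = at-k ; sole-bullet = sole }
  where
  uncrossed : ∀ l → initial k l ≢ crs
  uncrossed l with k ≟ l
  ... | yes _ = λ ()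
  ... | no  _ = λ ()
  at-k : initial k k ≡ bul
  at-k rewrite dec-true (k ≟ k) refl = refl
  sole : ∀ l → initial k l ≡ bul → l ≡ k
  sole l with k ≟ l
  ... | yes k≡l = λ _ → sym k≡l
  ... | no  _   = λ ()

registers≡0⇒initial : ∀ {m} {c : Fin (suc m) → Content} (valid : Valid c) → registers c ≡ (0 , 0) →
                 ∀ k → c k ≡ initial (Valid.bullet valid) k
registers≡0⇒initial {c = c} valid regs≡0 k with Valid.bullet valid ≟ k
... | yes refl = Valid.at-bullet valid
... | no b≢k   = zero-content (b≢k ∘ sym ∘ Valid.sole-bullet valid k) (Valid.uncrossed valid k)
                   (count≡0⇒absent RA c (cong proj₁ regs≡0) k) (count≡0⇒absent RB c (cong proj₂ regs≡0) k)
  where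
  zero-content : ∀ {d} → d ≢ bul → d ≢ crs → d ≢ cA → d ≢ cB → d ≡ zer
  zero-content {bul} d≢• _ _ _ = contradiction refl d≢•
  zero-content {crs} _ d≢× _ _ = contradiction refl d≢×
  zero-content {zer} _ _ _ _   = refl
  zero-content {cA}  _ _ d≢A _ = contradiction refl d≢A
  zero-content {cB}  _ _ _ d≢B = contradiction refl d≢B

incr : Reg → ℕ × ℕ → ℕ × ℕ
incr RA (a , b) = suc a , b
incr RB (a , b) = a , suc b

value : Reg → ℕ × ℕ → ℕ
value RA = proj₁
value RB = proj₂

value-registers : ∀ {m} R (c : Fin m → Content) → value R (registers c) ≡ count R c
value-registers RA c = refl
value-registers RB c = refl

value-incr : ∀ R r → value R (incr R r) ≡ suc (value R r)
value-incr RA r = refl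
value-incr RB r = refl

incr-injective : ∀ R {r r′} → incr R r ≡ incr R r′ → r ≡ r′
incr-injective RA refl = refl
incr-injective RB refl = refl

value≡suc⇒incr : ∀ R r {a} → value R r ≡ suc a → ∃ λ r′ → r ≡ incr R r′
value≡suc⇒incr RA (.(suc a) , b) {a} refl = (a , b) , refl
value≡suc⇒incr RB (a , .(suc b)) {b} refl = (a , b) , refl

load-incr : ∀ R r → load (incr R r) ≡ suc (load r)
load-incr RA (a , b) = refl
load-incr RB (a , b) = +-suc a b

registers-incr : ∀ {m m′} R {c : Fin m → Content} {c′ : Fin m′ → Content} →
                 (∀ R′ → count R′ c′ ≡ count R′ c + occ R′ (reg R)) →
                 registers c′ ≡ incr R (registers c)
registers-incr RA h = cong₂ _,_ (trans (h RA) (+-comm _ 1)) (trans (h RB) (+-identityʳ _))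
registers-incr RB h = cong₂ _,_ (trans (h RA) (+-identityʳ _)) (trans (h RB) (+-comm _ 1))

-- The uncrossed coordinates (x, y, M(x, y)) at a state whose instruction is executed:
-- the bullet of x moves to the position of the bullet of y.
data Move (v w u : Content) : Content → Content → Content → Set where
  at-x : Move v w u bul v w
  at-y : Move v w u u bul bul
  keep : ∀ {c} → c ≢ bul → c ≢ crs → Move v w u c c c

IncMove DecMove : Reg → Content → Content → Content → Set
IncMove R = Move zer (reg R) zer
DecMove R = Move (reg R) zer (reg R)

module _ {v w u : Content} where

  Move-at-x : ∀ {c d e} → Move v w u c d e → c ≡ bul → u ≢ bul → d ≡ v × e ≡ w
  Move-at-x at-x         _   _   = refl , refl
  Move-at-x at-y         u≡• u≢• = contradiction u≡• u≢•
  Move-at-x (keep c≢• _) c≡• _   = contradiction c≡• c≢•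

  Move-at-y : ∀ {c d e} → Move v w u c d e → d ≡ bul → v ≢ bul → c ≡ u × e ≡ bul
  Move-at-y at-x         v≡• v≢• = contradiction v≡• v≢•
  Move-at-y at-y         _   _   = refl , refl
  Move-at-y (keep c≢• _) c≡• _   = contradiction c≡• c≢•

  Move-keep : ∀ {c d e} → Move v w u c d e → c ≢ bul → d ≢ bul → c ≡ e × d ≡ e
  Move-keep at-x     c≢• _   = contradiction refl c≢•
  Move-keep at-y     _   d≢• = contradiction refl d≢•
  Move-keep (keep _ _) _ _   = refl , refl

  Move-uncrossedˡ : ∀ {c d e} → u ≢ crs → Move v w u c d e → c ≢ crs
  Move-uncrossedˡ _   at-x         = λ ()
  Move-uncrossedˡ u≢× at-y         = u≢×
  Move-uncrossedˡ _   (keep _ c≢×) = c≢×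

  Move-uncrossedʳ : ∀ {c d e} → v ≢ crs → Move v w u c d e → d ≢ crs
  Move-uncrossedʳ v≢× at-x         = v≢×
  Move-uncrossedʳ _   at-y         = λ ()
  Move-uncrossedʳ _   (keep _ c≢×) = c≢×

  Move-bullet : ∀ {c d e} → Move v w u c d e → e ≡ bul → w ≢ bul → d ≡ bul
  Move-bullet at-x         w≡• w≢• = contradiction w≡• w≢•
  Move-bullet at-y         _   _   = refl
  Move-bullet (keep c≢• _) c≡• _   = contradiction c≡• c≢•

  module _ {m} (v≢• : v ≢ bul) (u≢• : u ≢ bul) {x y z : Fin (suc m) → Content}
           (moves : ∀ k → Move v w u (x k) (y k) (z k)) (valid-x : Valid x) (valid-y : Valid y) where
    open Valid valid-x using () renaming (bullet to kx; at-bullet to x-kx; sole-bullet to x-sole)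
    open Valid valid-y using () renaming (bullet to ky; at-bullet to y-ky; sole-bullet to y-sole)

    private
      at-kx : y kx ≡ v × z kx ≡ w
      at-kx = Move-at-x (moves kx) x-kx u≢•

      at-ky : x ky ≡ u × z ky ≡ bul
      at-ky = Move-at-y (moves ky) y-ky v≢•

      kx≢ky : kx ≢ ky
      kx≢ky refl = u≢• (trans (sym (proj₁ at-ky)) x-kx)

      elsewhere : ∀ k → k ≢ kx → k ≢ ky → x k ≡ z k × y k ≡ z k
      elsewhere k k≢kx k≢ky = Move-keep (moves k) (k≢kx ∘ x-sole k) (k≢ky ∘ y-sole k)

    move-counts : ∀ R → count R z + occ R u ≡ count R x + occ R w
                      × count R z + occ R v ≡ count R y + occ R w
    move-counts R = x-count , y-count
      where
      open ≡-Reasoning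
      z≈x : ∀ k → k ≢ kx → k ≢ ky → occ R (z k) ≡ occ R (x k)
      z≈x k k≢kx k≢ky = cong (occ R) (sym (proj₁ (elsewhere k k≢kx k≢ky)))
      x-count : count R z + occ R u ≡ count R x + occ R w
      x-count = begin
        count R z + occ R u                     ≡⟨ cong (_+ occ R u) (+-identityʳ _) ⟨
        count R z + occ R bul + occ R u         ≡⟨ cong₂ (λ a b → count R z + occ R a + occ R b) x-kx (proj₁ at-ky) ⟨
        count R z + occ R (x kx) + occ R (x ky) ≡⟨ sum-agree-off₂ (occ R ∘ z) (occ R ∘ x) kx≢ky z≈x ⟩
        count R x + occ R (z kx) + occ R (z ky) ≡⟨ cong₂ (λ a b → count R x + occ R a + occ R b)
                                                         (proj₂ at-kx) (proj₂ at-ky) ⟩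
        count R x + occ R w + occ R bul         ≡⟨ +-identityʳ _ ⟩
        count R x + occ R w                     ∎
      z≈y : ∀ k → k ≢ kx → occ R (z k) ≡ occ R (y k)
      z≈y k k≢kx with k ≟ ky
      ... | yes refl = cong (occ R) (trans (proj₂ at-ky) (sym y-ky))
      ... | no k≢ky  = cong (occ R) (sym (proj₂ (elsewhere k k≢kx k≢ky)))
      y-count : count R z + occ R v ≡ count R y + occ R w
      y-count = begin
        count R z + occ R v       ≡⟨ cong (λ a → count R z + occ R a) (proj₁ at-kx) ⟨
        count R z + occ R (y kx)  ≡⟨ sum-agree-off (occ R ∘ z) (occ R ∘ y) kx z≈y ⟩
        count R y + occ R (z kx)  ≡⟨ cong (λ a → count R y + occ R a) (proj₂ at-kx) ⟩
        count R y + occ R w       ∎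

inc-registers : ∀ {m} R {x y z : Fin (suc m) → Content} → (∀ k → IncMove R (x k) (y k) (z k)) →
                Valid x → Valid y → registers z ≡ incr R (registers x) × registers z ≡ incr R (registers y)
inc-registers R {x} {y} {z} moves valid-x valid-y =
  registers-incr R {x} {z} (λ R′ → trans (sym (+-identityʳ _)) (proj₁ (counts R′))) ,
  registers-incr R {y} {z} (λ R′ → trans (sym (+-identityʳ _)) (proj₂ (counts R′)))
  where counts = move-counts (λ ()) (λ ()) moves valid-x valid-y

dec-registers : ∀ {m} R {x y z : Fin (suc m) → Content} → (∀ k → DecMove R (x k) (y k) (z k)) →
                Valid x → Valid y → registers x ≡ incr R (registers z) × registers y ≡ incr R (registers z)
dec-registers R {x} {y} {z} moves valid-x valid-y =
  registers-incr R {z} {x} (λ R′ → trans (sym (+-identityʳ _)) (sym (proj₁ (counts R′)))) ,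
  registers-incr R {z} {y} (λ R′ → trans (sym (+-identityʳ _)) (sym (proj₂ (counts R′))))
  where counts = move-counts (reg≢bul R) (reg≢bul R) moves valid-x valid-y

MovePreimage : ∀ {m} → Content → Content → Content → (Fin (suc m) → Content) → Set
MovePreimage v w u z = ∃ λ x → ∃ λ y → Valid x × Valid y × ∀ k → Move v w u (x k) (y k) (z k)

module _ {m} {v w u : Content} (v≢• : v ≢ bul) (v≢× : v ≢ crs) (u≢• : u ≢ bul) (u≢× : u ≢ crs)
         {z : Fin (suc m) → Content} (valid-z : Valid z) {k₁} (z-k₁ : z k₁ ≡ w) (w≢• : w ≢ bul) where
  open Valid valid-z renaming (bullet to k₀)

  private
    x y : Fin (suc m) → Content
    x k with k ≟ k₁ | k ≟ k₀
    ... | yes _ | _     = bul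
    ... | no _  | yes _ = u
    ... | no _  | no _  = z k
    y k with k ≟ k₁
    ... | yes _ = v
    ... | no _  = z k

    moves : ∀ k → Move v w u (x k) (y k) (z k)
    moves k with k ≟ k₁ | k ≟ k₀
    ... | yes refl | _        = subst (Move v w u bul v) (sym z-k₁) at-x
    ... | no _     | yes refl = subst (λ c → Move v w u u c c) (sym at-bullet) at-y
    ... | no _     | no k≢k₀  = keep (k≢k₀ ∘ sole-bullet k) (uncrossed k)

    valid-x : Valid x
    valid-x = record { uncrossed = unc ; bullet = k₁ ; at-bullet = at ; sole-bullet = sole }
      where
      unc : ∀ k → x k ≢ crs
      unc k with k ≟ k₁ | k ≟ k₀
      ... | yes _ | _     = λ ()
      ... | no _  | yes _ = u≢×
      ... | no _  | no _  = uncrossed k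
      at : x k₁ ≡ bul
      at with k₁ ≟ k₁ | k₁ ≟ k₀
      ... | yes _ | _ = refl
      ... | no k₁≢k₁ | _ = contradiction refl k₁≢k₁
      sole : ∀ k → x k ≡ bul → k ≡ k₁
      sole k with k ≟ k₁ | k ≟ k₀
      ... | yes k≡k₁ | _       = λ _ → k≡k₁
      ... | no _     | yes _   = λ u≡• → contradiction u≡• u≢•
      ... | no _     | no k≢k₀ = λ z≡• → contradiction (sole-bullet k z≡•) k≢k₀

    valid-y : Valid y
    valid-y = record { uncrossed = unc ; bullet = k₀ ; at-bullet = at ; sole-bullet = sole }
      where
      unc : ∀ k → y k ≢ crs
      unc k with k ≟ k₁
      ... | yes _ = v≢×
      ... | no _  = uncrossed k
      at : y k₀ ≡ bul
      at with k₀ ≟ k₁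
      ... | yes refl = contradiction (trans (sym z-k₁) at-bullet) w≢•
      ... | no _     = at-bullet
      sole : ∀ k → y k ≡ bul → k ≡ k₀
      sole k with k ≟ k₁
      ... | yes _ = λ v≡• → contradiction v≡• v≢•
      ... | no _  = sole-bullet k

  preimage : MovePreimage v w u z
  preimage = x , y , valid-x , valid-y , moves

module _ {n : ℕ} where

  -- The same-state branch of M, shared by both kinds of instruction (see opM-same).
  moveM : State n → Content → Content → Content → Content → Content → Elem n
  moveM j v w u c d =
    if (c == bul) ∧ (d == v) then (j , w)
    else if (c == u) ∧ (d == bul) then (j , bul)
    else if (c == d) ∧ not (c == bul) then (j , c)
    else (j , crs)

  moveM-state : ∀ j v w u c d → st (moveM j v w u c d) ≡ j
  moveM-state j v w u c d =
    if-elim P ((c == bul) ∧ (d == v)) (λ _ → refl) λ _ →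
    if-elim P ((c == u) ∧ (d == bul)) (λ _ → refl) λ _ →
    if-elim P ((c == d) ∧ not (c == bul)) (λ _ → refl) (λ _ → refl)
    where
    P : Elem n → Set
    P out = st out ≡ j

  moveM-sound : ∀ {j v w u c d e} → u ≢ bul → Move v w u c d e → moveM j v w u c d ≡ (j , e)
  moveM-sound {v = v} _ at-x rewrite ==-refl v = refl
  moveM-sound {u = u} u≢• at-y rewrite ≢⇒==-false u≢• | ==-refl u = refl
  moveM-sound {u = u} _ (keep {c} c≢• _)
    rewrite ≢⇒==-false c≢• | ∧-zeroʳ (c == u) | ==-refl c = refl

  moveM-complete : ∀ {j v w u c d} → ct (moveM j v w u c d) ≢ crs →
                   Move v w u c d (ct (moveM j v w u c d))
  moveM-complete {j} {v} {w} {u} {c} {d} =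
    if-elim P ((c == bul) ∧ (d == v)) (λ e _ → at-x′ (∧-true e)) λ _ →
    if-elim P ((c == u) ∧ (d == bul)) (λ e _ → at-y′ (∧-true e)) λ _ →
    if-elim P ((c == d) ∧ not (c == bul)) (λ e c≢× → keep′ (∧-true e) c≢×) λ _ ne → contradiction refl ne
    where
    P : Elem n → Set
    P out = ct out ≢ crs → Move v w u c d (ct out)
    at-x′ : (c == bul) ≡ true × (d == v) ≡ true → Move v w u c d w
    at-x′ (c≡• , d≡v) rewrite ==⇒≡ c≡• | ==⇒≡ d≡v = at-x
    at-y′ : (c == u) ≡ true × (d == bul) ≡ true → Move v w u c d bul
    at-y′ (c≡u , d≡•) rewrite ==⇒≡ c≡u | ==⇒≡ d≡• = at-y
    keep′ : (c == d) ≡ true × not (c == bul) ≡ true → c ≢ crs → Move v w u c d c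
    keep′ (c≡d , c≢•) c≢× with ==⇒≡ c≡d
    ... | refl = keep (not==⇒≢ c≢•) c≢×

  next : Instr n → State n
  next (inc _ j)   = j
  next (dec _ _ j) = j

  MoveOf : Instr n → Content → Content → Content → Set
  MoveOf (inc R _)   = IncMove R
  MoveOf (dec R _ _) = DecMove R

  moveAt : Instr n → Content → Content → Elem n
  moveAt (inc R j)   = moveM j zer (reg R) zer
  moveAt (dec R _ j) = moveM j (reg R) zer (reg R)

  moveAt-sound : ∀ ins {c d e} → MoveOf ins c d e → moveAt ins c d ≡ (next ins , e)
  moveAt-sound (inc R j)   = moveM-sound λ ()
  moveAt-sound (dec R k j) = moveM-sound (reg≢bul R)

  moveAt-state : ∀ ins {c d} → st (moveAt ins c d) ≡ next ins
  moveAt-state (inc R j)   {c} {d} = moveM-state j zer (reg R) zer c d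
  moveAt-state (dec R k j) {c} {d} = moveM-state j (reg R) zer (reg R) c d

  moveAt-complete : ∀ ins {c d} → ct (moveAt ins c d) ≢ crs →
                    MoveOf ins c d (ct (moveAt ins c d)) × st (moveAt ins c d) ≡ next ins
  moveAt-complete ins ne = complete ins ne , moveAt-state ins
    where
    complete : ∀ ins {c d} → ct (moveAt ins c d) ≢ crs → MoveOf ins c d (ct (moveAt ins c d))
    complete (inc R j)   = moveM-complete
    complete (dec R k j) = moveM-complete

  MoveOf-uncrossedˡ : ∀ (ins : Instr n) {c d e} → MoveOf ins c d e → c ≢ crs
  MoveOf-uncrossedˡ (inc R j)   = Move-uncrossedˡ λ ()
  MoveOf-uncrossedˡ (dec R k j) = Move-uncrossedˡ (reg≢crs R)

  MoveOf-uncrossedʳ : ∀ (ins : Instr n) {c d e} → MoveOf ins c d e → d ≢ crs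
  MoveOf-uncrossedʳ (inc R j)   = Move-uncrossedʳ λ ()
  MoveOf-uncrossedʳ (dec R k j) = Move-uncrossedʳ (reg≢crs R)

  MoveOf-bullet : ∀ (ins : Instr n) {c d e} → MoveOf ins c d e → e ≡ bul → d ≡ bul
  MoveOf-bullet (inc R j)   mv e≡• = Move-bullet mv e≡• (reg≢bul R)
  MoveOf-bullet (dec R k j) mv e≡• = Move-bullet mv e≡• λ ()

  MoveOf-at-y : ∀ (ins : Instr n) {c d e} → MoveOf ins c d e → d ≡ bul → e ≡ bul
  MoveOf-at-y (inc R j)   mv d≡• = proj₂ (Move-at-y mv d≡• λ ())
  MoveOf-at-y (dec R k j) mv d≡• = proj₂ (Move-at-y mv d≡• (reg≢bul R))

module Operations {n} (M : Machine n) where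
  open Ops M

  step-inc : ∀ {p R j} → δ M p ≡ inc R j → ∀ r → step M (suc p , r) ≡ (j , incr R r)
  step-inc {R = RA} e r rewrite e = refl
  step-inc {R = RB} e r rewrite e = refl

  step-dec : ∀ {p R k j} → δ M p ≡ dec R k j → ∀ r → step M (suc p , incr R r) ≡ (j , r)
  step-dec {R = RA} e r rewrite e = refl
  step-dec {R = RB} e r rewrite e = refl

  step-dec-zero : ∀ {p R k j} → δ M p ≡ dec R k j → ∀ r → value R r ≡ 0 → step M (suc p , r) ≡ (k , r)
  step-dec-zero {R = RA} e (.0 , b) refl rewrite e = refl
  step-dec-zero {R = RB} e (a , .0) refl rewrite e = refl

  opM-same : ∀ {p ins} → δ M p ≡ ins → ∀ c d → opM (suc p , c) (suc p , d) ≡ moveAt ins c d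
  opM-same {p} {inc R j}   e c d rewrite =ˢ-refl (suc p) | e = refl
  opM-same {p} {dec R k j} e c d rewrite =ˢ-refl (suc p) | e = refl

  opM-move : ∀ {p ins c d e} → δ M p ≡ ins → MoveOf ins c d e → opM (suc p , c) (suc p , d) ≡ (next ins , e)
  opM-move {ins = ins} {c} {d} δp≡ins mv = trans (opM-same δp≡ins c d) (moveAt-sound ins mv)

  opM-state : ∀ {a a′ b b′} → st a ≡ st a′ → st b ≡ st b′ → st (opM a b) ≡ st (opM a′ b′)
  opM-state {i , c} {_ , c′} {i′ , d} {_ , d′} refl refl = by-cases i i′ (i ≟ i′)
    where
    by-cases : ∀ i i′ → Dec (i ≡ i′) → st (opM (i , c) (i′ , d)) ≡ st (opM (i , c′) (i′ , d′))
    by-cases zero    _ (yes refl) = refl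
    by-cases (suc p) _ (yes refl) = begin
      st (opM (suc p , c) (suc p , d))   ≡⟨ cong st (opM-same refl c d) ⟩
      st (moveAt (δ M p) c d)            ≡⟨ moveAt-state (δ M p) ⟩
      next (δ M p)                       ≡⟨ moveAt-state (δ M p) ⟨
      st (moveAt (δ M p) c′ d′)          ≡⟨ cong st (opM-same refl c′ d′) ⟨
      st (opM (suc p , c′) (suc p , d′)) ∎
      where open ≡-Reasoning
    by-cases i i′ (no i≢i′) rewrite dec-false (i ≟ i′) i≢i′ = refl

  opM-uncrossed : ∀ a b → ct (opM a b) ≢ crs →
                  ∃ λ p → st a ≡ suc p × st b ≡ suc p
                        × MoveOf (δ M p) (ct a) (ct b) (ct (opM a b)) × st (opM a b) ≡ next (δ M p)
  opM-uncrossed a b ne = by-state a b (synchronous ne) ne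
    where
    synchronous : ct (opM a b) ≢ crs → st a ≡ st b
    synchronous = if-elim (λ out → ct out ≢ crs → st a ≡ st b) (st a =ˢ st b)
                    (λ e _ → =ˢ⇒≡ e) (λ _ ne → contradiction refl ne)
    by-state : ∀ a b → st a ≡ st b → ct (opM a b) ≢ crs →
               ∃ λ p → st a ≡ suc p × st b ≡ suc p
                     × MoveOf (δ M p) (ct a) (ct b) (ct (opM a b)) × st (opM a b) ≡ next (δ M p)
    by-state (zero  , c) (_ , d) refl ne = contradiction refl ne
    by-state (suc p , c) (_ , d) refl ne rewrite opM-same {p} refl c d =
      p , refl , refl , moveAt-complete (δ M p) ne

  opM'-state : ∀ {a a′} → st a ≡ st a′ → st (opM' a) ≡ st (opM' a′)
  opM'-state {i , c} {_ , c′} refl with instr M i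
  ... | nothing        = refl
  ... | just (inc R j) = refl
  ... | just (dec R k j) =
    trans (if-elim (λ out → st out ≡ k) (not (c == reg R)) (λ _ → refl) (λ _ → refl))
          (sym (if-elim (λ out → st out ≡ k) (not (c′ == reg R)) (λ _ → refl) (λ _ → refl)))

  opM'-dec : ∀ {p R k j c} → δ M p ≡ dec R k j → c ≢ reg R → opM' (suc p , c) ≡ (k , c)
  opM'-dec e c≢R rewrite e | ≢⇒==-false c≢R = refl

  opM'-at : ∀ {p R k j} a → st a ≡ suc p → δ M p ≡ dec R k j → ct (opM' a) ≢ crs →
            ct a ≢ reg R × opM' a ≡ (k , ct a)
  opM'-at {R = R} (_ , c) refl e ne rewrite e with c == reg R in c≡R
  ... | true  = contradiction refl ne
  ... | false = ==-false⇒≢ c≡R , refl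

  opM'-uncrossed : ∀ a → ct (opM' a) ≢ crs →
                   ∃ λ p → st a ≡ suc p × ∃ λ R → ∃ λ k → ∃ λ j → δ M p ≡ dec R k j
  opM'-uncrossed (zero  , c) ne = contradiction refl ne
  opM'-uncrossed (suc p , c) ne with δ M p in e
  ... | inc R j   = contradiction refl ne
  ... | dec R k j = p , refl , R , k , j , e

  st-⊓ : ∀ (a b : Elem n) → st (a ⊓ b) ≡ minS (st a) (st b)
  st-⊓ a b = if-elim (λ out → st out ≡ minS (st a) (st b)) (a =ᵉ b)
               (λ e → sym (minS-≡ˡ (cong st (=ᵉ⇒≡ e))))
               (λ _ → refl)

  ⊓-uncrossed : ∀ (a b : Elem n) → ct (a ⊓ b) ≢ crs → a ⊓ b ≡ a
  ⊓-uncrossed a b =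
    if-elim (λ out → ct out ≢ crs → out ≡ a) (a =ᵉ b) (λ _ _ → refl) (λ _ ne → contradiction refl ne)

  st-opI : ∀ a b → st (opI a b) ≡ one
  st-opI a b = if-elim (λ out → st out ≡ one) (isD a) (λ _ → refl) λ _ →
               if-elim (λ out → st out ≡ one) (isC b) (λ _ → refl) (λ _ → refl)

  opI-uncrossed : ∀ a b → ct (opI a b) ≢ crs →
                  (InD a × opI a b ≡ (one , bul)) ⊎ (¬ InD a × ¬ InD b × InY b × opI a b ≡ (one , zer))
  opI-uncrossed a b = if-elim P (isD a) (λ a∈D _ → inj₁ (==⇒≡ a∈D , refl)) λ a∉D →
                      if∧-elim P (not (isD b))
                        (λ b∈C _ → let b∉D , b∉X = ∧-true b∈C
                                   in inj₂ (==-false⇒≢ a∉D , not==⇒≢ b∉D , not==⇒≢ b∉X , refl))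
                        (λ _ ne → contradiction refl ne)
    where
    P : Elem n → Set
    P out = ct out ≢ crs → (InD a × out ≡ (one , bul)) ⊎ (¬ InD a × ¬ InD b × InY b × out ≡ (one , zer))

  opI-D : ∀ {a} b → InD a → opI a b ≡ (one , bul)
  opI-D {i , .bul} b refl = refl

  opI-C : ∀ {a b} → ¬ InD a → ¬ InD b → InY b → opI a b ≡ (one , zer)
  opI-C a∉D b∉D b∈Y rewrite ≢⇒==-false a∉D | ≢⇒==-false b∉D | ≢⇒==-false b∈Y = refl

  st-opH : ∀ a → st (opH a) ≡ zero
  st-opH a = if-elim (λ out → st out ≡ zero) ((a =ᵉ (zero , zer)) ∨ (a =ᵉ (zero , bul)))
               (λ _ → refl) (λ _ → refl)

  opH-bullet : ∀ a → ¬ InD (opH a)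
  opH-bullet a = if-elim (λ out → ¬ InD out) ((a =ᵉ (zero , zer)) ∨ (a =ᵉ (zero , bul))) (λ _ ()) (λ _ ())

  opH-uncrossed : ∀ a → ct (opH a) ≢ crs → a ≡ (zero , zer) ⊎ a ≡ (zero , bul)
  opH-uncrossed a = if-elim P ((a =ᵉ (zero , zer)) ∨ (a =ᵉ (zero , bul))) (λ e _ → halted (∨-true e))
                      (λ _ ne → contradiction refl ne)
    where
    P : Elem n → Set
    P out = ct out ≢ crs → a ≡ (zero , zer) ⊎ a ≡ (zero , bul)
    halted : (a =ᵉ (zero , zer)) ≡ true ⊎ (a =ᵉ (zero , bul)) ≡ true → a ≡ (zero , zer) ⊎ a ≡ (zero , bul)
    halted (inj₁ e) = inj₁ (=ᵉ⇒≡ e)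
    halted (inj₂ e) = inj₂ (=ᵉ⇒≡ e)

  st-opN₀ : ∀ a b c → st (opN₀ a b c) ≡ minS (st b) (st c)
  st-opN₀ a b c =
    if∧-elim P (a =ᵉ (zero , bul)) (λ e → sym (minS-≡ˡ (=ˢ⇒≡ (proj₂ (∧-true e))))) λ _ →
    if∧-elim P (a =ᵉ (zero , zer)) (λ e → sym (minS-≡ʳ (synchronous e))) λ _ →
    st-⊓ b c
    where
    P : Elem n → Set
    P out = st out ≡ minS (st b) (st c)
    synchronous : (a =ᵉ (zero , zer)) ∧ not (isD c) ∧ (st b =ˢ st c) ≡ true → st b ≡ st c
    synchronous e = =ˢ⇒≡ (proj₂ (∧-true {not (isD c)} (proj₂ (∧-true {a =ᵉ (zero , zer)} e))))

  opN₀-uncrossed : ∀ a b c → ct (opN₀ a b c) ≢ crs →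
                   a ≡ (zero , bul) ⊎ (a ≡ (zero , zer) × ¬ InD (opN₀ a b c))
  opN₀-uncrossed a b c =
    if∧-elim P (a =ᵉ (zero , bul)) (λ e _ → inj₁ (=ᵉ⇒≡ (proj₁ (∧-true e)))) λ _ →
    if∧-elim P (a =ᵉ (zero , zer))
      (λ e _ → let a≡0 , rest = ∧-true {a =ᵉ (zero , zer)} e
               in inj₂ (=ᵉ⇒≡ a≡0 , not==⇒≢ (proj₁ (∧-true {not (isD c)} rest))))
      (λ _ ne → contradiction refl ne)
    where
    P : Elem n → Set
    P out = ct out ≢ crs → a ≡ (zero , bul) ⊎ (a ≡ (zero , zer) × ¬ InD out)

  st-opS : ∀ a b c → st (opS a b c) ≡ one
  st-opS a b c = if∧-elim (λ out → st out ≡ one) (a =ᵉ (one , zer)) (λ _ → refl) (λ _ → refl)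

  opS-bullet : ∀ a b c → ¬ InD (opS a b c)
  opS-bullet a b c = if∧-elim (λ out → ¬ InD out) (a =ᵉ (one , zer)) (λ _ ()) (λ _ ())

  opS-uncrossed : ∀ a b c → ct (opS a b c) ≢ crs → a ≡ (one , zer)
  opS-uncrossed a b c = if∧-elim (λ out → ct out ≢ crs → a ≡ (one , zer)) (a =ᵉ (one , zer))
                          (λ e _ → =ᵉ⇒≡ (proj₁ (∧-true e))) (λ _ ne → contradiction refl ne)

  module _ (u x y z : Elem n) where
    private
      s : Bool
      s = (st x =ˢ st y) ∧ (st y =ˢ st z)

      s⇒ : ∀ {b} → s ∧ b ≡ true → st x ≡ st y × st y ≡ st z
      s⇒ e = let x≡y , y≡z = ∧-true (proj₁ (∧-true {s} e)) in =ˢ⇒≡ x≡y , =ˢ⇒≡ y≡z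

      u∈D : ∀ {b} → s ∧ isD u ∧ b ≡ true → InD u
      u∈D e = ==⇒≡ (proj₁ (∧-true {isD u} (proj₂ (∧-true {s} e))))

    st-opN• : st (opN• u x y z) ≡ minS (minS (st x) (st y)) (st z)
    st-opN• =
      if∧-elim P s (λ e → sym (min≡ (s⇒ e))) λ _ →
      if∧-elim P s (λ e → sym (min≡ (s⇒ e))) λ _ →
      if∧-elim P s (λ e → sym (trans (min≡ (s⇒ e)) (proj₁ (s⇒ e)))) λ _ →
      if∧-elim P s (λ e → sym (trans (min≡ (s⇒ e)) (trans (proj₁ (s⇒ e)) (proj₂ (s⇒ e))))) λ _ →
      trans (st-⊓ (x ⊓ y) z) (cong (λ i → minS i (st z)) (st-⊓ x y))
      where
      P : Elem n → Set
      P out = st out ≡ minS (minS (st x) (st y)) (st z)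
      min≡ : st x ≡ st y × st y ≡ st z → minS (minS (st x) (st y)) (st z) ≡ st x
      min≡ (x≡y , y≡z) = trans (cong (λ i → minS i (st z)) (minS-≡ˡ x≡y)) (minS-≡ˡ (trans x≡y y≡z))

    opN•-uncrossed : ct (opN• u x y z) ≢ crs →
                     (opN• u x y z ≡ x × opN• u x y z ≡ y) ⊎ (InD u × (opN• u x y z ≡ x ⊎ opN• u x y z ≡ y))
    opN•-uncrossed =
      if∧-elim P s (λ e _ → inj₁ (refl , =ᵉ⇒≡ (proj₁ (∧-true {x =ᵉ y} (proj₂ (∧-true {s} e)))))) λ _ →
      if∧-elim P s (λ e _ → inj₂ (u∈D e , inj₁ refl)) λ _ →
      if∧-elim P s (λ e _ → inj₂ (u∈D e , inj₂ refl)) λ _ →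
      if∧-elim P s (λ e _ → inj₂ (u∈D e , z≡x⊎y (∨-true (proj₂ (∧-true {isD u} (proj₂ (∧-true {s} e)))))))
        λ _ ne → contradiction refl ne
      where
      P : Elem n → Set
      P out = ct out ≢ crs → (out ≡ x × out ≡ y) ⊎ (InD u × (out ≡ x ⊎ out ≡ y))
      z≡x⊎y : (z =ᵉ x) ≡ true ⊎ (z =ᵉ y) ≡ true → z ≡ x ⊎ z ≡ y
      z≡x⊎y (inj₁ e) = inj₁ (=ᵉ⇒≡ e)
      z≡x⊎y (inj₂ e) = inj₂ (=ᵉ⇒≡ e)

  move-step : ∀ {m p} ins → δ M p ≡ ins → {x y z : Fin (suc m) → Content} →
              (∀ k → MoveOf ins (x k) (y k) (z k)) → Valid x → Valid y →
              step M (suc p , registers x) ≡ (next ins , registers z)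
  move-step (inc R j) e moves valid-x valid-y =
    trans (step-inc e _) (cong (j ,_) (sym (proj₁ (inc-registers R moves valid-x valid-y))))
  move-step {p = p} (dec R k j) e moves valid-x valid-y =
    trans (cong (λ r → step M (suc p , r)) (proj₁ (dec-registers R moves valid-x valid-y))) (step-dec e _)

module Runs {n} (M : Machine n) (C : ℕ) where

  CappedUpTo : ℕ → Set
  CappedUpTo t = ∀ t′ → t′ ≤ t → load (proj₂ (run M t′ init)) ≤ C

  Reached : Config n → Set
  Reached c = ∃ λ t → run M t init ≡ c × CappedUpTo t

  reached-init : Reached init
  reached-init = 0 , refl , λ { .0 z≤n → z≤n }

  reached-step : ∀ {c c′} → Reached c → step M c ≡ c′ → load (proj₂ c′) ≤ C → Reached c′
  reached-step {c′ = c′} (t , run≡c , capped) step≡c′ load≤C = suc t , run≡c′ , capped′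
    where
    run≡c′ : run M (suc t) init ≡ c′
    run≡c′ = trans (cong (step M) run≡c) step≡c′
    capped′ : CappedUpTo (suc t)
    capped′ t′ t′≤1+t with m≤n⇒m<n∨m≡n t′≤1+t
    ... | inj₁ (s≤s t′≤t) = capped t′ t′≤t
    ... | inj₂ refl       = subst (λ c → load (proj₂ c) ≤ C) (sym run≡c′) load≤C

  run-halted : ∀ t → proj₁ (run M t init) ≡ zero → ∀ d → run M (d + t) init ≡ run M t init
  run-halted t halted zero    = refl
  run-halted t halted (suc d) rewrite run-halted t halted d with run M t init
  ... | (zero , _) = refl

  reached-halted : ∀ {r} → Reached (zero , r) → HaltsWithCapacity M C
  reached-halted {r} (t , run≡ , capped) = has-capacity , t , cong proj₁ run≡
    where
    has-capacity : HasCapacity M C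
    has-capacity t′ i α β run≡′ with t′ ≤? t
    ... | yes t′≤t = subst (λ c → load (proj₂ c) ≤ C) run≡′ (capped t′ t′≤t)
    ... | no  t′≰t = subst (λ c → load (proj₂ c) ≤ C) (trans (sym later) run≡′) (capped t ≤-refl)
      where
      later : run M t′ init ≡ run M t init
      later = trans (cong (λ s → run M s init) (sym (m∸n+n≡m (≤-trans (n≤1+n t) (≰⇒> t′≰t)))))
                    (run-halted t (cong proj₁ run≡) (t′ ∸ t))

module SInvariant {n} (M : Machine n) (m : ℕ) where
  open Ops M
  open Operations M
  open Runs M m

  Column : Set
  Column = Fin (suc m) → Elem n

  contents : Column → Fin (suc m) → Content
  contents g = ct ∘ g

  Synchronous AtMostOneBullet Uncrossed : Column → Set
  Synchronous g     = ∀ k l → st (g k) ≡ st (g l)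
  AtMostOneBullet g = ∀ k l → InD (g k) → InD (g l) → k ≡ l
  Uncrossed g       = ∀ k → InY (g k)

  EncodesRun : Column → Set
  EncodesRun g = ∃ λ k → InD (g k) × Reached (st (g k) , registers (contents g))

  record Invariant (g : Column) : Set where
    field
      synchronous : Synchronous g
      one-bullet  : AtMostOneBullet g
      encodes     : Uncrossed g → HaltsWithCapacity M m ⊎ EncodesRun g
  open Invariant

  valid-column : ∀ {g} → Uncrossed g → AtMostOneBullet g → ∀ {k} → InD (g k) → Valid (contents g)
  valid-column unc one {k} g-k =
    record { uncrossed = unc ; bullet = k ; at-bullet = g-k ; sole-bullet = λ l g-l → one l k g-l g-k }

  bullets-reflect : ∀ {g h : Column} → AtMostOneBullet g → (∀ k → InD (h k) → InD (g k)) → AtMostOneBullet h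
  bullets-reflect one reflect k l h-k h-l = one k l (reflect k h-k) (reflect l h-l)

  Invariant-resp : ∀ {g h} → (∀ k → g k ≡ h k) → Invariant g → Invariant h
  Invariant-resp {g} {h} g≗h inv = record
    { synchronous = λ k l → trans (cong st (sym (g≗h k))) (trans (synchronous inv k l) (cong st (g≗h l)))
    ; one-bullet  = bullets-reflect {g} {h} (one-bullet inv) λ k → subst InD (sym (g≗h k))
    ; encodes     = λ unc → map₂ transport (encodes inv λ k → subst InY (sym (g≗h k)) (unc k))
    }
    where
    transport : EncodesRun g → EncodesRun h
    transport (k , g-k , reached) =
      k , subst InD (g≗h k) g-k ,
      subst Reached (cong₂ _,_ (cong st (g≗h k)) (registers-cong (cong ct ∘ g≗h))) reached

  halts-of-halted : ∀ {g} → Invariant g → (∀ k → g k ≡ (zero , zer) ⊎ g k ≡ (zero , bul)) →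
                    HaltsWithCapacity M m
  halts-of-halted {g} inv halted = [ id , from-run ]′ (encodes inv (proj₂ ∘ at))
    where
    at : ∀ k → st (g k) ≡ zero × InY (g k)
    at k with halted k
    ... | inj₁ g-k = cong st g-k , λ g-k∈X → contradiction (trans (sym (cong ct g-k)) g-k∈X) λ ()
    ... | inj₂ g-k = cong st g-k , λ g-k∈X → contradiction (trans (sym (cong ct g-k)) g-k∈X) λ ()
    from-run : EncodesRun g → HaltsWithCapacity M m
    from-run (k , _ , reached) = reached-halted (subst Reached (cong (_, registers (contents g)) (proj₁ (at k))) reached)

  halts-of-bulletless : ∀ {g} → Invariant g → Uncrossed g → (∀ k → ¬ InD (g k)) → HaltsWithCapacity M m
  halts-of-bulletless inv unc bulletless =
    [ id , (λ (k , g-k , _) → contradiction g-k (bulletless k)) ]′ (encodes inv unc)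

  σ-column : Fin (suc m) → Column
  σ-column k l = if does (k ≟ l) then (one , bul) else (one , zer)

  σ-column≡initial : ∀ k l → σ-column k l ≡ (one , initial k l)
  σ-column≡initial k l = if-pair (does (k ≟ l))

  invariant-σ : ∀ k → Invariant (σ-column k)
  invariant-σ k = Invariant-resp (sym ∘ σ-column≡initial k) (record
    { synchronous = λ _ _ → refl
    ; one-bullet  = λ l l′ b b′ → trans (sole-bullet l b) (sym (sole-bullet l′ b′))
    ; encodes     = λ _ → inj₂ (k , at-bullet , subst Reached (cong (one ,_) (sym (registers-initial k))) reached-init)
    })
    where open Valid (valid-initial k)

  module _ {x y : Column} (inv-x : Invariant x) (inv-y : Invariant y) where

    invariant-⊓ : Invariant (λ k → x k ⊓ y k)
    invariant-⊓ = record
      { synchronous = λ k l → trans (st-⊓ (x k) (y k))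
                                (trans (cong₂ minS (synchronous inv-x k l) (synchronous inv-y k l)) (sym (st-⊓ (x l) (y l))))
      ; one-bullet  = bullets-reflect {x} {λ k → x k ⊓ y k} (one-bullet inv-x) λ k w-k →
                        subst InD (⊓-uncrossed (x k) (y k) (D⇒Y {a = x k ⊓ y k} w-k)) w-k
      ; encodes     = λ unc → encodes (Invariant-resp (λ k → sym (⊓-uncrossed (x k) (y k) (unc k))) inv-x) unc
      }

    invariant-M : Invariant (λ k → opM (x k) (y k))
    invariant-M = record
      { synchronous = λ k l → opM-state (synchronous inv-x k l) (synchronous inv-y k l)
      ; one-bullet  = one-bullet-w
      ; encodes     = λ unc → let p , x₀ , y₀ , _ = opM-uncrossed (x zero) (y zero) (unc zero) in encodes-at p x₀ y₀ unc
      }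
      where
      w : Column
      w k = opM (x k) (y k)

      one-bullet-w : AtMostOneBullet w
      one-bullet-w = bullets-reflect {y} {w} (one-bullet inv-y) λ k w-k →
        let p , _ , _ , move , _ = opM-uncrossed (x k) (y k) (D⇒Y {a = w k} w-k) in MoveOf-bullet (δ M p) move w-k

      encodes-at : ∀ p → st (x zero) ≡ suc p → st (y zero) ≡ suc p → Uncrossed w →
                   HaltsWithCapacity M m ⊎ EncodesRun w
      encodes-at p x₀ y₀ unc = combine (encodes inv-x x-unc) (encodes inv-y y-unc)
        where
        ins = δ M p
        w≡move : ∀ k → w k ≡ moveAt ins (ct (x k)) (ct (y k))
        w≡move k = trans (cong₂ opM (elem-at (trans (synchronous inv-x k zero) x₀))
                                    (elem-at (trans (synchronous inv-y k zero) y₀)))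
                         (opM-same refl (ct (x k)) (ct (y k)))
        moves : ∀ k → MoveOf ins (ct (x k)) (ct (y k)) (ct (w k)) × st (w k) ≡ next ins
        moves k = subst (λ out → MoveOf ins (ct (x k)) (ct (y k)) (ct out) × st out ≡ next ins) (sym (w≡move k))
                        (moveAt-complete ins (subst (λ out → ct out ≢ crs) (w≡move k) (unc k)))
        x-unc : Uncrossed x
        x-unc k = MoveOf-uncrossedˡ ins (proj₁ (moves k))
        y-unc : Uncrossed y
        y-unc k = MoveOf-uncrossedʳ ins (proj₁ (moves k))
        combine : HaltsWithCapacity M m ⊎ EncodesRun x → HaltsWithCapacity M m ⊎ EncodesRun y →
                  HaltsWithCapacity M m ⊎ EncodesRun w
        combine (inj₁ halts) _ = inj₁ halts
        combine (inj₂ _) (inj₁ halts) = inj₁ halts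
        combine (inj₂ (kx , x-kx , reached-x)) (inj₂ (ky , y-ky , _)) =
          inj₂ (ky , w-ky , reached-step reached-x′ step≡ (load≤ (valid-column {w} unc one-bullet-w w-ky)))
          where
          w-ky : InD (w ky)
          w-ky = MoveOf-at-y ins (proj₁ (moves ky)) y-ky
          reached-x′ : Reached (suc p , registers (contents x))
          reached-x′ = subst Reached (cong (_, registers (contents x)) (trans (synchronous inv-x kx zero) x₀)) reached-x
          step≡ : step M (suc p , registers (contents x)) ≡ (st (w ky) , registers (contents w))
          step≡ = trans (move-step ins refl (proj₁ ∘ moves) (valid-column {x} x-unc (one-bullet inv-x) x-kx)
                                                          (valid-column {y} y-unc (one-bullet inv-y) y-ky))
                        (cong (_, registers (contents w)) (sym (proj₂ (moves ky))))

    invariant-I : Invariant (λ k → opI (x k) (y k))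
    invariant-I = record
      { synchronous = λ k l → trans (st-opI (x k) (y k)) (sym (st-opI (x l) (y l)))
      ; one-bullet  = bullets-reflect {x} {w} (one-bullet inv-x) λ k w-k → from-x k (D⇒Y {a = w k} w-k) w-k
      ; encodes     = encodes-w
      }
      where
      w : Column
      w k = opI (x k) (y k)
      shape : ∀ k → InY (w k) →
              (InD (x k) × w k ≡ (one , bul)) ⊎ (¬ InD (x k) × ¬ InD (y k) × InY (y k) × w k ≡ (one , zer))
      shape k = opI-uncrossed (x k) (y k)
      from-x : ∀ k → InY (w k) → InD (w k) → InD (x k)
      from-x k w-k∈Y w-k with shape k w-k∈Y
      ... | inj₁ (x-k , _)         = x-k
      ... | inj₂ (_ , _ , _ , w≡0) = contradiction (trans (sym w-k) (cong ct w≡0)) λ ()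
      encodes-w : Uncrossed w → HaltsWithCapacity M m ⊎ EncodesRun w
      encodes-w unc with any? (λ k → ct (x k) ≟ᶜ bul)
      ... | yes (k₀ , x-k₀) =
        inj₂ (k₀ , cong ct w-k₀ , subst Reached (cong₂ _,_ (sym (cong st w-k₀)) (sym registers≡0)) reached-init)
        where
        w-k₀ : w k₀ ≡ (one , bul)
        w-k₀ = opI-D {x k₀} (y k₀) x-k₀
        no-register : ∀ R k → ct (w k) ≢ reg R
        no-register R k with shape k (unc k)
        ... | inj₁ (_ , w≡•)         = λ •≡R → reg≢bul R (trans (sym •≡R) (cong ct w≡•))
        ... | inj₂ (_ , _ , _ , w≡0) = λ 0≡R → reg≢zer R (trans (sym 0≡R) (cong ct w≡0))
        registers≡0 : registers (contents w) ≡ (0 , 0)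
        registers≡0 = cong₂ _,_ (absent⇒count≡0 RA _ (no-register RA)) (absent⇒count≡0 RB _ (no-register RB))
      ... | no none = inj₁ (halts-of-bulletless inv-y y-unc y-bulletless)
        where
        y-facts : ∀ k → ¬ InD (y k) × InY (y k)
        y-facts k with shape k (unc k)
        ... | inj₁ (x-k , _)                 = contradiction (k , x-k) none
        ... | inj₂ (_ , y∉D , y∈Y , _) = y∉D , y∈Y
        y-unc : Uncrossed y
        y-unc = proj₂ ∘ y-facts
        y-bulletless : ∀ k → ¬ InD (y k)
        y-bulletless = proj₁ ∘ y-facts

  module _ {x : Column} (inv-x : Invariant x) where

    invariant-M' : Invariant (λ k → opM' (x k))
    invariant-M' = record
      { synchronous = λ k l → opM'-state (synchronous inv-x k l)
      ; one-bullet  = one-bullet-w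
      ; encodes     = λ unc → let p , x₀ , R , k′ , j , e = opM'-uncrossed (x zero) (unc zero) in encodes-at x₀ e unc
      }
      where
      w : Column
      w k = opM' (x k)

      one-bullet-w : AtMostOneBullet w
      one-bullet-w = bullets-reflect {x} {w} (one-bullet inv-x) λ k w-k →
        let p , x-k , R , k′ , j , e = opM'-uncrossed (x k) (D⇒Y {a = w k} w-k)
        in trans (cong ct (sym (proj₂ (opM'-at (x k) x-k e (D⇒Y {a = w k} w-k))))) w-k

      encodes-at : ∀ {p R k′ j} → st (x zero) ≡ suc p → δ M p ≡ dec R k′ j → Uncrossed w →
                   HaltsWithCapacity M m ⊎ EncodesRun w
      encodes-at {p} {R} {k′} x₀ e unc = map₂ advance (encodes inv-x x-unc)
        where
        at : ∀ k → ct (x k) ≢ reg R × w k ≡ (k′ , ct (x k))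
        at k = opM'-at (x k) (trans (synchronous inv-x k zero) x₀) e (unc k)
        same-contents : ∀ k → ct (x k) ≡ ct (w k)
        same-contents k = cong ct (sym (proj₂ (at k)))
        x-unc : Uncrossed x
        x-unc k = subst (_≢ crs) (sym (same-contents k)) (unc k)
        advance : EncodesRun x → EncodesRun w
        advance (kx , x-kx , reached) =
          kx , w-kx , reached-step reached′ step≡ (load≤ (valid-column {w} unc one-bullet-w w-kx))
          where
          w-kx : InD (w kx)
          w-kx = trans (sym (same-contents kx)) x-kx
          reached′ : Reached (suc p , registers (contents x))
          reached′ = subst Reached (cong (_, registers (contents x)) (trans (synchronous inv-x kx zero) x₀)) reached
          R-empty : value R (registers (contents x)) ≡ 0
          R-empty = trans (value-registers R (contents x)) (absent⇒count≡0 R (contents x) (proj₁ ∘ at))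
          step≡ : step M (suc p , registers (contents x)) ≡ (st (w kx) , registers (contents w))
          step≡ = trans (step-dec-zero e _ R-empty)
                        (cong₂ _,_ (sym (cong st (proj₂ (at kx)))) (registers-cong same-contents))

    invariant-H : Invariant (λ k → opH (x k))
    invariant-H = record
      { synchronous = λ k l → trans (st-opH (x k)) (sym (st-opH (x l)))
      ; one-bullet  = λ k _ w-k → contradiction w-k (opH-bullet (x k))
      ; encodes     = λ unc → inj₁ (halts-of-halted inv-x λ k → opH-uncrossed (x k) (unc k))
      }

    module _ {y z : Column} (sync-y : Synchronous y) (sync-z : Synchronous z) where

      invariant-N₀ : Invariant (λ k → opN₀ (x k) (y k) (z k))
      invariant-N₀ = record
        { synchronous = λ k l → trans (st-opN₀ (x k) (y k) (z k))
                                  (trans (cong₂ minS (sync-y k l) (sync-z k l)) (sym (st-opN₀ (x l) (y l) (z l))))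
        ; one-bullet  = bullets-reflect {x} {w} (one-bullet inv-x) λ k w-k → from-x k w-k
        ; encodes     = λ unc → inj₁ (halts-of-halted inv-x λ k → halted k (unc k))
        }
        where
        w : Column
        w k = opN₀ (x k) (y k) (z k)
        from-x : ∀ k → InD (w k) → InD (x k)
        from-x k w-k with opN₀-uncrossed (x k) (y k) (z k) (D⇒Y {a = w k} w-k)
        ... | inj₁ x≡•       = cong ct x≡•
        ... | inj₂ (_ , w∉D) = contradiction w-k w∉D
        halted : ∀ k → InY (w k) → x k ≡ (zero , zer) ⊎ x k ≡ (zero , bul)
        halted k w-k∈Y with opN₀-uncrossed (x k) (y k) (z k) w-k∈Y
        ... | inj₁ x≡•       = inj₂ x≡•
        ... | inj₂ (x≡0 , _) = inj₁ x≡0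

    invariant-S : ∀ {y z : Column} → Invariant (λ k → opS (x k) (y k) (z k))
    invariant-S {y} {z} = record
      { synchronous = λ k l → trans (st-opS (x k) (y k) (z k)) (sym (st-opS (x l) (y l) (z l)))
      ; one-bullet  = λ k _ w-k → contradiction w-k (opS-bullet (x k) (y k) (z k))
      ; encodes     = λ unc → inj₁ (halts-of-bulletless inv-x (λ k → x-unc k (unc k)) λ k → x-bulletless k (unc k))
      }
      where
      x-unc : ∀ k → InY (opS (x k) (y k) (z k)) → InY (x k)
      x-unc k w-k∈Y x-k∈X = contradiction (trans (sym (cong ct (opS-uncrossed (x k) (y k) (z k) w-k∈Y))) x-k∈X) λ ()
      x-bulletless : ∀ k → InY (opS (x k) (y k) (z k)) → ¬ InD (x k)
      x-bulletless k w-k∈Y x-k∈D = contradiction (trans (sym (cong ct (opS-uncrossed (x k) (y k) (z k) w-k∈Y))) x-k∈D) λ ()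

  module _ {u x y : Column} (inv-u : Invariant u) (inv-x : Invariant x) (inv-y : Invariant y) where

    invariant-N• : ∀ {z : Column} → Synchronous z → Invariant (λ k → opN• (u k) (x k) (y k) (z k))
    invariant-N• {z} sync-z = record
      { synchronous = λ k l → trans (st-opN• (u k) (x k) (y k) (z k))
                                (trans (cong₂ minS (cong₂ minS (synchronous inv-x k l) (synchronous inv-y k l)) (sync-z k l))
                                       (sym (st-opN• (u l) (x l) (y l) (z l))))
      ; one-bullet  = one-bullet-w
      ; encodes     = encodes-w
      }
      where
      w : Column
      w k = opN• (u k) (x k) (y k) (z k)
      shape : ∀ k → InY (w k) → (w k ≡ x k × w k ≡ y k) ⊎ (InD (u k) × (w k ≡ x k ⊎ w k ≡ y k))
      shape k = opN•-uncrossed (u k) (x k) (y k) (z k)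

      source : ∀ k → InD (w k) → (InD (x k) × InD (y k)) ⊎ (InD (u k) × (InD (x k) ⊎ InD (y k)))
      source k w-k with shape k (D⇒Y {a = w k} w-k)
      ... | inj₁ (w≡x , w≡y)       = inj₁ (subst InD w≡x w-k , subst InD w≡y w-k)
      ... | inj₂ (u-k , inj₁ w≡x) = inj₂ (u-k , inj₁ (subst InD w≡x w-k))
      ... | inj₂ (u-k , inj₂ w≡y) = inj₂ (u-k , inj₂ (subst InD w≡y w-k))

      one-bullet-w : AtMostOneBullet w
      one-bullet-w k l w-k w-l with source k w-k | source l w-l
      ... | inj₁ (x-k , _)       | inj₁ (x-l , _)       = one-bullet inv-x k l x-k x-l
      ... | inj₁ (x-k , _)       | inj₂ (_ , inj₁ x-l) = one-bullet inv-x k l x-k x-l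
      ... | inj₁ (_ , y-k)       | inj₂ (_ , inj₂ y-l) = one-bullet inv-y k l y-k y-l
      ... | inj₂ (_ , inj₁ x-k) | inj₁ (x-l , _)       = one-bullet inv-x k l x-k x-l
      ... | inj₂ (_ , inj₂ y-k) | inj₁ (_ , y-l)       = one-bullet inv-y k l y-k y-l
      ... | inj₂ (u-k , _)       | inj₂ (u-l , _)       = one-bullet inv-u k l u-k u-l

      elsewhere : ∀ q → InD (u q) → Uncrossed w → ∀ k → k ≢ q → w k ≡ x k × w k ≡ y k
      elsewhere q u-q unc k k≢q with shape k (unc k)
      ... | inj₁ agree      = agree
      ... | inj₂ (u-k , _) = contradiction (one-bullet inv-u k q u-k u-q) k≢q

      column-x : ∀ q → InD (u q) → Uncrossed w → w q ≡ x q → ∀ k → w k ≡ x k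
      column-x q u-q unc w≡x k with k ≟ q
      ... | yes refl = w≡x
      ... | no k≢q   = proj₁ (elsewhere q u-q unc k k≢q)

      column-y : ∀ q → InD (u q) → Uncrossed w → w q ≡ y q → ∀ k → w k ≡ y k
      column-y q u-q unc w≡y k with k ≟ q
      ... | yes refl = w≡y
      ... | no k≢q   = proj₂ (elsewhere q u-q unc k k≢q)

      -- away from the (unique) bullet of u, N• is the identity on agreeing x and y
      encodes-w : Uncrossed w → HaltsWithCapacity M m ⊎ EncodesRun w
      encodes-w unc with any? (λ k → ct (u k) ≟ᶜ bul)
      ... | no none = encodes (Invariant-resp (λ k → sym (w≡x k)) inv-x) unc
        where
        w≡x : ∀ k → w k ≡ x k
        w≡x k with shape k (unc k)
        ... | inj₁ (w≡x , _) = w≡x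
        ... | inj₂ (u-k , _) = contradiction (k , u-k) none
      ... | yes (q , u-q) with shape q (unc q)
      ... | inj₁ (w≡x , _)       = encodes (Invariant-resp (λ k → sym (column-x q u-q unc w≡x k)) inv-x) unc
      ... | inj₂ (_ , inj₁ w≡x) = encodes (Invariant-resp (λ k → sym (column-x q u-q unc w≡x k)) inv-x) unc
      ... | inj₂ (_ , inj₂ w≡y) = encodes (Invariant-resp (λ k → sym (column-y q u-q unc w≡y k)) inv-y) unc

  invariant-P : ∀ {u v x y : Column} → Synchronous u → Synchronous v → Invariant x → Invariant y →
                Invariant (λ k → opP (u k) (v k) (x k) (y k))
  invariant-P {u} {v} {x} {y} sync-u sync-v inv-x inv-y = choose (st (u zero) =ˢ st (v zero)) refl
    where
    condition : ∀ k → (st (u k) =ˢ st (v k)) ≡ (st (u zero) =ˢ st (v zero))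
    condition k = cong₂ _=ˢ_ (sync-u k zero) (sync-v k zero)
    choose : ∀ b → (st (u zero) =ˢ st (v zero)) ≡ b → Invariant (λ k → opP (u k) (v k) (x k) (y k))
    choose true  e = Invariant-resp (λ k → cong (λ b → if b then x k else y k) (sym (trans (condition k) e))) inv-x
    choose false e = Invariant-resp (λ k → cong (λ b → if b then x k else y k) (sym (trans (condition k) e))) inv-y

  tabulated : ∀ {g : Column} → Invariant g → Invariant (lookup (tabulate g))
  tabulated {g} = Invariant-resp λ k → sym (lookup∘tabulate g k)

  invariant : ∀ {r} → S (suc m) r → Invariant (lookup r)
  invariant (gen k)         = tabulated (invariant-σ k)
  invariant (g-∧ r∈S s∈S)  = tabulated (invariant-⊓ (invariant r∈S) (invariant s∈S))
  invariant (g-M r∈S s∈S)  = tabulated (invariant-M (invariant r∈S) (invariant s∈S))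
  invariant (g-M' r∈S)     = tabulated (invariant-M' (invariant r∈S))
  invariant (g-I r∈S s∈S)  = tabulated (invariant-I (invariant r∈S) (invariant s∈S))
  invariant (g-H r∈S)      = tabulated (invariant-H (invariant r∈S))
  invariant (g-N₀ {s = s} {t} r∈S s∈S t∈S) =
    tabulated (invariant-N₀ (invariant r∈S) {lookup s} {lookup t} (synchronous (invariant s∈S))
                                                                   (synchronous (invariant t∈S)))
  invariant (g-S {s = s} {t} r∈S _ _) = tabulated (invariant-S (invariant r∈S) {lookup s} {lookup t})
  invariant (g-N• {u = u} r∈S s∈S t∈S u∈S) =
    tabulated (invariant-N• (invariant r∈S) (invariant s∈S) (invariant t∈S) {lookup u} (synchronous (invariant u∈S)))
  invariant (g-P {r} {s} r∈S s∈S t∈S u∈S) =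
    tabulated (invariant-P {lookup r} {lookup s} (synchronous (invariant r∈S)) (synchronous (invariant s∈S))
                           (invariant t∈S) (invariant u∈S))

module Embedding {n} (M : Machine n) {ℓ m} (f : Fin (suc m) → Fin ℓ) (f-injective : Injective _≡_ _≡_ f) where
  open Ops M
  open Operations M

  embed : (Fin (suc m) → Content) → Fin ℓ → Content
  embed c q with any? (λ k → f k ≟ q)
  ... | yes (k , _) = c k
  ... | no  _       = zer

  embed-cases : ∀ q → (∃ λ k → f k ≡ q × ∀ c → embed c q ≡ c k)
                    ⊎ ((∀ k → f k ≢ q) × ∀ c → embed c q ≡ zer)
  embed-cases q with any? (λ k → f k ≟ q)
  ... | yes (k , fk≡q) = inj₁ (k , fk≡q , λ _ → refl)
  ... | no  none       = inj₂ ((λ k fk≡q → none (k , fk≡q)) , λ _ → refl)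

  embed-preserves : ∀ (P : Content → Content → Content → Set) → P zer zer zer →
                    ∀ {x y z} → (∀ k → P (x k) (y k) (z k)) → ∀ q → P (embed x q) (embed y q) (embed z q)
  embed-preserves P p₀ {x} {y} {z} pₖ q with embed-cases q
  ... | inj₁ (k , _ , at-k) rewrite at-k x | at-k y | at-k z = pₖ k
  ... | inj₂ (_ , outside)  rewrite outside x | outside y | outside z = p₀

  tuple : State n → (Fin (suc m) → Content) → Tuple ℓ
  tuple i c = tabulate λ q → (i , embed c q)

  lookup-tuple : ∀ i c q → lookup (tuple i c) q ≡ (i , embed c q)
  lookup-tuple i c q = lookup∘tabulate (λ q → (i , embed c q)) q

  tuple-cong : ∀ i {c c′} → (∀ k → c k ≡ c′ k) → tuple i c ≡ tuple i c′
  tuple-cong i {c} {c′} c≗c′ =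
    tabulate-cong λ q → cong (i ,_) (embed-preserves (λ a _ b → a ≡ b) refl {c} {c} {c′} c≗c′ q)

  lift2-tuple : ∀ (op : Elem n → Elem n → Elem n) {i i′ j} (P : Content → Content → Content → Set) →
                (∀ {a b e} → P a b e → op (i , a) (i′ , b) ≡ (j , e)) → P zer zer zer →
                ∀ {x y z} → (∀ k → P (x k) (y k) (z k)) → lift2 op (tuple i x) (tuple i′ y) ≡ tuple j z
  lift2-tuple op {i} {i′} {j} P sound p₀ {x} {y} {z} pₖ = tabulate-cong λ q →
    trans (cong₂ op (lookup-tuple i x q) (lookup-tuple i′ y q)) (sound (embed-preserves P p₀ pₖ q))

  lift1-tuple : ∀ (op : Elem n → Elem n) {i j} (P : Content → Set) →
                (∀ {a} → P a → op (i , a) ≡ (j , a)) → P zer →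
                ∀ {c} → (∀ k → P (c k)) → lift1 op (tuple i c) ≡ tuple j c
  lift1-tuple op {i} P sound p₀ {c} pₖ = tabulate-cong λ q →
    trans (cong op (lookup-tuple i c q)) (sound (embed-preserves (λ a _ _ → P a) p₀ {c} {c} {c} pₖ q))

  embed-initial : ∀ k q → embed (initial k) q ≡ (if does (f k ≟ q) then bul else zer)
  embed-initial k q with embed-cases q
  ... | inj₁ (k′ , refl , at-k′) =
    trans (at-k′ (initial k)) (cong (if_then bul else zer) (does-⇔ same (k ≟ k′) (f k ≟ f k′)))
    where
    same : k ≡ k′ ⇔ f k ≡ f k′
    same = mk⇔ (cong f) f-injective
  ... | inj₂ (outside , zero-pad) rewrite dec-false (f k ≟ q) (outside k) = zero-pad (initial k)

  module _ {R : Pred (Tuple ℓ) 0ℓ} (relation : IsRelation R) where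
    open IsRelation relation

    initial-tuple : Computational R → ∀ {r} k → r ∈ R → (∀ q → InY (lookup r q)) → InD (lookup r (f k)) →
                    tuple one (initial k) ∈ R
    initial-tuple computational {r} k r∈R unc r-fk = subst R (tabulate-cong opI-at) (cl-I r∈R r∈R)
      where
      opI-at : ∀ q → opI (lookup r q) (lookup r q) ≡ (one , embed (initial k) q)
      opI-at q rewrite embed-initial k q with f k ≟ q
      ... | yes refl = opI-D {lookup r (f k)} (lookup r (f k)) r-fk
      ... | no fk≢q  = opI-C {lookup r q} {lookup r q} r-q∉D r-q∉D (unc q)
        where
        r-q∉D : ¬ InD (lookup r q)
        r-q∉D r-q = fk≢q (sym (proj₂ (computational r r∈R) q (f k) r-q r-fk))

    module Simulation (initials : ∀ k → tuple one (initial k) ∈ R) where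

      Simulated : Config n → Set
      Simulated (i , r) = ∀ c → Valid c → registers c ≡ r → tuple i c ∈ R

      simulated-init : Simulated init
      simulated-init c valid-c regs≡0 =
        subst R (tuple-cong one (sym ∘ registers≡0⇒initial valid-c regs≡0)) (initials (Valid.bullet valid-c))

      simulated-inc : ∀ {p R′ j} → δ M p ≡ inc R′ j → ∀ {r} → Simulated (suc p , r) → Simulated (j , incr R′ r)
      simulated-inc {p} {R′} {j} e {r} simulated z valid-z regs-z =
        from-preimage (preimage {v = zer} {u = zer} (λ ()) (λ ()) (λ ()) (λ ()) valid-z (proj₂ present) (reg≢bul R′))
        where
        present : ∃ λ k → z k ≡ reg R′
        present = count-suc⇒present R′ z
                    (trans (sym (value-registers R′ z)) (trans (cong (value R′) regs-z) (value-incr R′ r)))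
        before : ∀ r′ → registers z ≡ incr R′ r′ → r′ ≡ r
        before r′ regs-z′ = incr-injective R′ (trans (sym regs-z′) regs-z)
        from-preimage : MovePreimage zer (reg R′) zer z → tuple j z ∈ R
        from-preimage (x , y , valid-x , valid-y , moves) with inc-registers R′ {x} {y} {z} moves valid-x valid-y
        ... | regs-x , regs-y =
          subst R (lift2-tuple opM (IncMove R′) (opM-move e) (keep (λ ()) (λ ())) moves)
                  (cl-M (simulated x valid-x (before _ regs-x)) (simulated y valid-y (before _ regs-y)))

      simulated-dec : ∀ {p R′ k j} → δ M p ≡ dec R′ k j → ∀ {r} → load (incr R′ r) ≤ m →
                      Simulated (suc p , incr R′ r) → Simulated (j , r)
      simulated-dec {p} {R′} {j = j} e {r} bound simulated z valid-z regs-z =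
        from-preimage (preimage {v = reg R′} {u = reg R′} (reg≢bul R′) (reg≢crs R′) (reg≢bul R′) (reg≢crs R′)
                        valid-z (proj₂ free) λ ())
        where
        free : ∃ λ k → z k ≡ zer
        free = load<⇒zero valid-z (subst (λ r → suc (load r) ≤ m) (sym regs-z) (subst (_≤ m) (load-incr R′ r) bound))
        before : ∀ r′ → r′ ≡ incr R′ (registers z) → r′ ≡ incr R′ r
        before r′ r′≡ = trans r′≡ (cong (incr R′) regs-z)
        from-preimage : MovePreimage (reg R′) zer (reg R′) z → tuple j z ∈ R
        from-preimage (x , y , valid-x , valid-y , moves) with dec-registers R′ {x} {y} {z} moves valid-x valid-y
        ... | regs-x , regs-y =
          subst R (lift2-tuple opM (DecMove R′) (opM-move e) (keep (λ ()) (λ ())) moves)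
                  (cl-M (simulated x valid-x (before _ regs-x)) (simulated y valid-y (before _ regs-y)))

      simulated-dec-zero : ∀ {p R′ k j} → δ M p ≡ dec R′ k j → ∀ {r} → value R′ r ≡ 0 →
                           Simulated (suc p , r) → Simulated (k , r)
      simulated-dec-zero {R′ = R′} e {r} empty simulated z valid-z regs-z =
        subst R (lift1-tuple opM' (_≢ reg R′) (opM'-dec e) (λ 0≡R → reg≢zer R′ (sym 0≡R)) absent)
                (cl-M' (simulated z valid-z regs-z))
        where
        absent : ∀ k → z k ≢ reg R′
        absent = count≡0⇒absent R′ z (trans (sym (value-registers R′ z)) (trans (cong (value R′) regs-z) empty))

      simulated-step : ∀ {p} ins → δ M p ≡ ins → ∀ r → load r ≤ m →
                       Simulated (suc p , r) → Simulated (step M (suc p , r))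
      simulated-step (inc R′ j) e r _ simulated = subst Simulated (sym (step-inc e r)) (simulated-inc e simulated)
      simulated-step (dec R′ k j) e r bound simulated with value R′ r in value≡
      ... | zero  = subst Simulated (sym (step-dec-zero e r value≡)) (simulated-dec-zero e value≡ simulated)
      ... | suc _ with value≡suc⇒incr R′ r value≡
      ...   | r′ , refl = subst Simulated (sym (step-dec e r′)) (simulated-dec e bound simulated)

      simulated : HasCapacity M m → ∀ t → Simulated (run M t init)
      simulated capacity zero    = simulated-init
      simulated capacity (suc t) with run M t init in run≡ | simulated capacity t
      ... | zero  , r | sim = sim
      ... | suc p , r | sim = simulated-step (δ M p) refl r (capacity t (suc p) _ _ run≡) sim

      halting : Standing M → HaltsWithCapacity M m → Halting R
      halting standing (capacity , t , halted) = final , final∈R , coordinates , not-all-zero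
        where
        first : Fin (suc m)
        first = zero
        final : Tuple ℓ
        final = tuple zero (initial first)
        halted≡ : run M t init ≡ (zero , proj₂ (run M t init))
        halted≡ = cong (_, proj₂ (run M t init)) halted
        run≡ : run M t init ≡ (zero , 0 , 0)
        run≡ with Standing.clears standing t _ _ halted≡
        ... | α≡0 , β≡0 = trans halted≡ (cong (zero ,_) (cong₂ _,_ α≡0 β≡0))
        final∈R : final ∈ R
        final∈R = subst Simulated run≡ (simulated capacity t) (initial first) (valid-initial first) (registers-initial first)
        coordinate : ∀ q → lookup final q ≡ (zero , (if does (f first ≟ q) then bul else zer))
        coordinate q = trans (lookup-tuple zero (initial first) q) (cong (zero ,_) (embed-initial first q))
        coordinates : ∀ q → lookup final q ≡ (zero , zer) ⊎ lookup final q ≡ (zero , bul)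
        coordinates q with f first ≟ q | coordinate q
        ... | yes _ | at-q = inj₂ at-q
        ... | no  _ | at-q = inj₁ at-q
        not-all-zero : ¬ (∀ q → lookup final q ≡ (zero , zer))
        not-all-zero all-zero with f first ≟ f first | coordinate (f first)
        ... | yes _    | at-f0 = contradiction (trans (sym at-f0) (all-zero (f first))) λ ()
        ... | no f0≢f0 | _     = f0≢f0 refl

module Equivalence {n} (M : Machine n) (m : ℕ) where
  open Ops M
  open SInvariant M m using (Invariant; invariant; σ-column; σ-column≡initial; halts-of-halted)
  open Invariant using (synchronous; one-bullet)

  AllRelationsHalt : Set₁
  AllRelationsHalt =
    ∀ (ℓ : ℕ) (R : Pred (Tuple ℓ) 0ℓ) → IsRelation R → Computational R → RelCapacity R m → Halting R

  S-relation : IsRelation (S (suc m))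
  S-relation = record
    { nonempty = σ zero , gen zero
    ; cl-∧ = g-∧ ; cl-M = g-M ; cl-M' = g-M' ; cl-I = g-I ; cl-H = g-H
    ; cl-N₀ = g-N₀ ; cl-S = g-S ; cl-N• = g-N• ; cl-P = g-P
    }

  S-computational : Computational (S (suc m))
  S-computational r r∈S = synchronous (invariant r∈S) , one-bullet (invariant r∈S)

  S-capacity : RelCapacity (S (suc m)) m
  S-capacity = (λ k → k) , (λ k≡l → k≡l) , λ k → σ k , gen k , uncrossed k , bullet k
    where
    σ≡ : ∀ k l → lookup (σ k) l ≡ (one , initial k l)
    σ≡ k l = trans (lookup∘tabulate (σ-column k) l) (σ-column≡initial k l)
    uncrossed : ∀ k l → InY (lookup (σ k) l)
    uncrossed k l = subst InY (sym (σ≡ k l)) (Valid.uncrossed (valid-initial k) l)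
    bullet : ∀ k → InD (lookup (σ k) k)
    bullet k = subst InD (sym (σ≡ k k)) (Valid.at-bullet (valid-initial k))

  S-halting⇒halts : Halting (S (suc m)) → HaltsWithCapacity M m
  S-halting⇒halts (r , r∈S , halted , _) = halts-of-halted (invariant r∈S) halted

  halts⇒relations-halt : Standing M → HaltsWithCapacity M m → AllRelationsHalt
  halts⇒relations-halt standing halts ℓ R relation computational (f , f-injective , d-coordinates) =
    halting standing halts
    where
    open Embedding M f f-injective
    initials : ∀ k → tuple one (initial k) ∈ R
    initials k = let r , r∈R , unc , r-fk = d-coordinates k in initial-tuple relation computational k r∈R unc r-fk
    open Simulation relation initials using (halting)

  relations-halt⇒S-halting : AllRelationsHalt → Halting (S (suc m))
  relations-halt⇒S-halting all-halt = all-halt (suc m) (S (suc m)) S-relation S-computational S-capacity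

corollary5p13 : ∀ {n} (M : Machine n) → Standing M → ∀ (m : ℕ) → 1 ≤ m →
    let open Ops M in
    (HaltsWithCapacity M (m ∸ 1) ⇔ Halting (S m))
    × (Halting (S m) ⇔
       (∀ (ℓ : ℕ) (R : Pred (Tuple ℓ) 0ℓ) → IsRelation R → Computational R →
          RelCapacity R (m ∸ 1) → Halting R))
corollary5p13 M standing (suc m) _ =
  mk⇔ (relations-halt⇒S-halting ∘ halts⇒relations-halt standing) S-halting⇒halts ,
  mk⇔ (halts⇒relations-halt standing ∘ S-halting⇒halts) relations-halt⇒S-halting
  where open Equivalence M m
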